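{- Let $m,r_1,r_2$ be integers with $m\ge2$, $0<r_1<m$, $0<r_2<m$, $r_1\ne r_2$. Then, as formal power series in $x,y,q$, \[ \sum_{\lambda\in\mathcal{C}_{m,r_1,r_2}}x^{\alpha(\lambda)}y^{\beta(\lambda)}q^{|\lambda|}=\frac{(xyq^{r_1+r_2};q^m)_\infty}{(xq^{r_1};q^m)_\infty\,(yq^{r_2};q^m)_\infty}. \]
   Context: Notation: $(a;q)_\infty=\prod_{j\ge0}(1-aq^j)$; $|\lambda|$ is the sum of parts of $\lambda$. Write a partition as $(1^{\mu_1},2^{\mu_2},\dots)$ with $\mu_j$ the multiplicity of part $j$. A partition $\pi$ is an $(m,r_1,r_2)$-capsid if every part is equal to $r_1$ or congruent to $0$ or $r_2$ mod $m$, and: (i) if $\mu_{r_1}=0$ then all parts are congruent to $r_2$ mod $m$; (ii) if $\mu_{r_1}>0$ then $r_1$ is the smallest part, every part congruent to $0$ mod $m$ is $\le m\mu_{r_1}$, and all parts congruent to $r_2$ mod $m$ are $>m\mu_{r_1}$. $\mathcal{C}_{m,r_1,r_2}$ is the set of such capsids (including the empty partition). For $\lambda\in\mathcal{C}_{m,r_1,r_2}$, $\alpha(\lambda)=\mu_{r_1}$ and $\beta(\lambda)$ is the number of parts of $\lambda$ congruent to $r_2$ mod $m$. -}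

module Defs where

open import Data.Nat using (ℕ; zero; suc; _+_; _*_; _∸_; _≤_; _<_; NonZero)
open import Data.Nat.Properties using (_≟_)
open import Data.Nat.DivMod using (_%_)
open import Data.Integer as ℤ using (ℤ)
open import Data.Bool using (Bool; true; false; if_then_else_; _∧_)
open import Data.List using (List; []; _∷_; map; foldr; upTo)
open import Data.List.Relation.Unary.All using (All)
open import Data.List.Relation.Unary.Linked using (Linked)
open import Data.Product using (Σ; _×_; _,_)
open import Data.Sum using (_⊎_)
open import Relation.Nullary.Decidable using (⌊_⌋)
open import Relation.Binary.PropositionalEquality using (_≡_)

Partition : Set
Partition = Σ (List ℕ) (λ ps → All (0 <_) ps × Linked (λ a b → b ≤ a) ps)

parts : Partition → List ℕ
parts (ps , _) = ps

size : Partition → ℕ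
size π = foldr _+_ 0 (parts π)

countB : (ℕ → Bool) → List ℕ → ℕ
countB t [] = 0
countB t (p ∷ ps) = (if t p then 1 else 0) + countB t ps

mult : ℕ → Partition → ℕ
mult j π = countB (λ p → ⌊ p ≟ j ⌋) (parts π)

module _ (m r₁ r₂ : ℕ) .{{_ : NonZero m}} where

  AllowedPart : ℕ → Set
  AllowedPart p = (p ≡ r₁) ⊎ ((p % m ≡ 0) ⊎ (p % m ≡ r₂))

  PartCondII : ℕ → ℕ → Set
  PartCondII μ p = (p ≡ r₁) ⊎ (((p % m ≡ 0) × (p ≤ m * μ)) ⊎ ((p % m ≡ r₂) × (m * μ < p)))

  IsCapsid : Partition → Set
  IsCapsid π =
    All AllowedPart (parts π) ×
    ( ( (mult r₁ π ≡ 0) × All (λ p → p % m ≡ r₂) (parts π) )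
    ⊎ ( (0 < mult r₁ π) × (All (r₁ ≤_) (parts π) × All (PartCondII (mult r₁ π)) (parts π)) ) )

  α : Partition → ℕ
  α π = mult r₁ π

  β : Partition → ℕ
  β π = countB (λ p → ⌊ p % m ≟ r₂ ⌋) (parts π)

  CapsidsWith : ℕ → ℕ → ℕ → Set
  CapsidsWith a b n = Σ Partition (λ π → IsCapsid π × ((α π ≡ a) × ((β π ≡ b) × (size π ≡ n))))

-- Formal power series in x, y, q with integer coefficients:
-- S a b n is the coefficient of x^a y^b q^n.

Series : Set
Series = ℕ → ℕ → ℕ → ℤ

sumTo : ℕ → (ℕ → ℤ) → ℤ
sumTo zero f = f 0
sumTo (suc n) f = sumTo n f ℤ.+ f (suc n)

[_] : Bool → ℤ
[ true ] = ℤ.+ 1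
[ false ] = ℤ.+ 0

oneS : Series
oneS a b n = [ ⌊ a ≟ 0 ⌋ ∧ (⌊ b ≟ 0 ⌋ ∧ ⌊ n ≟ 0 ⌋) ]

_⊛_ : Series → Series → Series
(f ⊛ g) a b n =
  sumTo a (λ i → sumTo b (λ j → sumTo n (λ k →
    f i j k ℤ.* g (a ∸ i) (b ∸ j) (n ∸ k))))

infixl 7 _⊛_

oneMinus : ℕ → ℕ → ℕ → Series
oneMinus i j k a b n =
  oneS a b n ℤ.- [ ⌊ a ≟ i ⌋ ∧ (⌊ b ≟ j ⌋ ∧ ⌊ n ≟ k ⌋) ]

-- 1 / (1 - x^i y^j q^k) = Σ_{t ≥ 0} x^{it} y^{jt} q^{kt}   (used with k ≥ 1,
-- so only t ≤ n can contribute to the coefficient of q^n)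
geom : ℕ → ℕ → ℕ → Series
geom i j k a b n =
  sumTo n (λ t → [ ⌊ a ≟ i * t ⌋ ∧ (⌊ b ≟ j * t ⌋ ∧ ⌊ n ≟ k * t ⌋) ])

prodList : List Series → Series
prodList = foldr _⊛_ oneS

-- Infinite product Π_{j ≥ 0} F j, for factors with F j ≡ 1 (mod q^{j+1});
-- the coefficient of q^n is that of the finite product over j ≤ n.
infProd : (ℕ → Series) → Series
infProd F a b n = prodList (map F (upTo (suc n))) a b n

capsidRHS : ℕ → ℕ → ℕ → Series
capsidRHS m r₁ r₂ =
  infProd (λ j → oneMinus 1 1 (r₁ + r₂ + m * j)) ⊛
  infProd (λ j → geom 1 0 (r₁ + m * j)) ⊛
  infProd (λ j → geom 0 1 (r₂ + m * j))

module Submission where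

-- Both sides have coefficients satisfying one system of recurrences (CapsidRecurrence), which
-- determines them. For the product F = E X Y, write σ for the substitution x ↦ x qᵐ. Then
-- E = (1 - x y q^(r₁+r₂)) σE, X (1 - x q^r₁) = σX and σY = Y, hence
-- F (1 - x q^r₁) = σF (1 - x y q^(r₁+r₂)); moreover F = Y at x⁰, and Y (1 - y q^r₂) = Y(y qᵐ).
-- Comparing coefficients gives the recurrences. For capsids with α = a + 1, either the part
-- m (a + 1) occurs and can be removed, or it does not, and removing one r₁ leaves a capsid with
-- α = a and no part m a + r₂. For α = 0, either r₂ occurs and can be removed, or all the β parts
-- exceed m and can be lowered by m. These bijections give the same recurrences for the counts.

open import Algebra.Bundles using (CommutativeRing)
open import Data.Bool using (Bool; true; false; _∧_; if_then_else_)
open import Data.Bool.Properties using (∧-zeroʳ)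
open import Data.Empty using (⊥-elim)
open import Data.Fin as Fin using (Fin; #_)
open import Data.Fin.Permutation using (↔⇒≡)
open import Data.Fin.Properties using (+↔⊎)
open import Data.Integer as ℤ using (ℤ; +_)
open import Data.Integer.Properties as ℤₚ using ()
open import Data.Integer.Tactic.RingSolver using (solve-∀)
open import Data.List using (List; []; _∷_; length; map; applyUpTo)
open import Data.List.Properties using (length-map; map-∘; map-id-local)
open import Data.List.Relation.Unary.All as All using (All; []; _∷_)
import Data.List.Relation.Unary.All.Properties as Allₚ
open import Data.List.Relation.Unary.Linked as Linked using (Linked; []; [-]; _∷_)
open import Data.Nat as ℕ using (ℕ; zero; suc; _≤_; _<_; z≤n; s≤s; _∸_; NonZero)
open import Data.Nat.DivMod
  using (_%_; _/_; m≡m%n+[m/n]*n; m<n⇒m%n≡m; [m+kn]%n≡m%n; m*n%n≡0; [m+n]%n≡m%n; m≤n⇒[n∸m]%m≡n%m)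
open import Data.Nat.Induction using (<-rec)
open import Data.Nat.ListAction using (sum)
open import Data.Nat.Properties as ℕₚ using ()
open import Data.Nat.Tactic.RingSolver using () renaming (solve-∀ to ℕ-solve-∀)
open import Data.Product using (Σ; _×_; _,_; proj₁; proj₂)
open import Data.Sum using (_⊎_; inj₁; inj₂)
open import Data.Sum.Function.Propositional using (_⊎-↔_)
open import Data.Vec using ([]; _∷_)
open import Function using (_∘_; id)
open import Function.Bundles using (_↔_; Inverse; mk↔ₛ′)
open import Function.Properties.Inverse using (↔-sym; ↔-trans)
open import Relation.Binary.PropositionalEquality as ≡ using (_≡_; _≢_)
open import Relation.Binary.Structures using (IsEquivalence)
open import Relation.Nullary using (Dec; yes; no; ¬_; Irrelevant)
open import Relation.Nullary.Decidable using (⌊_⌋; dec-true; dec-false; isYes≗does)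
open import Relation.Unary using (Decidable)
open import Algebra.Properties.CommutativeSemigroup ℕₚ.+-commutativeSemigroup
  using () renaming (x∙yz≈y∙xz to x+[y+z]≡y+[x+z])

-- Formal power series over a commutative ring

module PowerSeries {c ℓ} (R : CommutativeRing c ℓ) where

  open CommutativeRing R hiding (zero)
  open import Algebra.Properties.CommutativeSemigroup +-commutativeSemigroup
    using () renaming (interchange to +-interchange)
  open import Algebra.Properties.CommutativeSemigroup *-commutativeSemigroup
    using () renaming (interchange to *-interchange)
  open import Relation.Binary.Reasoning.Setoid setoid

  ∑≤ : ℕ → (ℕ → Carrier) → Carrier
  ∑≤ zero f = f 0
  ∑≤ (suc n) f = ∑≤ n f + f (suc n)

  ∑-cong : ∀ n {f g : ℕ → Carrier} → (∀ i → i ≤ n → f i ≈ g i) → ∑≤ n f ≈ ∑≤ n g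
  ∑-cong zero f≈g = f≈g 0 z≤n
  ∑-cong (suc n) f≈g = +-cong (∑-cong n (λ i i≤n → f≈g i (ℕₚ.m≤n⇒m≤1+n i≤n))) (f≈g (suc n) ℕₚ.≤-refl)

  ∑-distrib-+ : ∀ n (f g : ℕ → Carrier) → ∑≤ n (λ i → f i + g i) ≈ ∑≤ n f + ∑≤ n g
  ∑-distrib-+ zero f g = refl
  ∑-distrib-+ (suc n) f g = trans (+-congʳ (∑-distrib-+ n f g)) (+-interchange _ _ _ _)

  *-distribˡ-∑ : ∀ n x (f : ℕ → Carrier) → x * ∑≤ n f ≈ ∑≤ n (λ i → x * f i)
  *-distribˡ-∑ zero x f = refl
  *-distribˡ-∑ (suc n) x f = trans (distribˡ _ _ _) (+-congʳ (*-distribˡ-∑ n x f))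

  *-distribʳ-∑ : ∀ n x (f : ℕ → Carrier) → ∑≤ n f * x ≈ ∑≤ n (λ i → f i * x)
  *-distribʳ-∑ zero x f = refl
  *-distribʳ-∑ (suc n) x f = trans (distribʳ _ _ _) (+-congʳ (*-distribʳ-∑ n x f))

  ∑-zero : ∀ n (f : ℕ → Carrier) → (∀ i → i ≤ n → f i ≈ 0#) → ∑≤ n f ≈ 0#
  ∑-zero zero f f≈0 = f≈0 0 z≤n
  ∑-zero (suc n) f f≈0 =
    trans (+-cong (∑-zero n f (λ i i≤n → f≈0 i (ℕₚ.m≤n⇒m≤1+n i≤n))) (f≈0 (suc n) ℕₚ.≤-refl)) (+-identityʳ 0#)

  ∑-unfoldˡ : ∀ n (f : ℕ → Carrier) → ∑≤ (suc n) f ≈ f 0 + ∑≤ n (λ i → f (suc i))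
  ∑-unfoldˡ zero f = refl
  ∑-unfoldˡ (suc n) f = trans (+-congʳ (∑-unfoldˡ n f)) (+-assoc _ _ _)

  ∑-reverse : ∀ n (f : ℕ → Carrier) → ∑≤ n f ≈ ∑≤ n (λ i → f (n ∸ i))
  ∑-reverse zero f = refl
  ∑-reverse (suc n) f = begin
    ∑≤ n f + f (suc n)                   ≈⟨ +-congʳ (∑-reverse n f) ⟩
    ∑≤ n (λ i → f (n ∸ i)) + f (suc n)   ≈⟨ +-comm _ _ ⟩
    f (suc n) + ∑≤ n (λ i → f (n ∸ i))   ≈⟨ ∑-unfoldˡ n (λ i → f (suc n ∸ i)) ⟨
    ∑≤ (suc n) (λ i → f (suc n ∸ i))     ∎

  ∑-single : ∀ n s (f : ℕ → Carrier) → s ≤ n → (∀ i → i ≤ n → i ≢ s → f i ≈ 0#) → ∑≤ n f ≈ f s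
  ∑-single zero .zero f z≤n _ = refl
  ∑-single (suc n) s f s≤1+n f≈0 with s ℕ.≟ suc n
  ... | yes ≡.refl = trans (+-congʳ (∑-zero n f (λ i i≤n → f≈0 i (ℕₚ.m≤n⇒m≤1+n i≤n)
                                                     (λ i≡ → ℕₚ.<-irrefl i≡ (s≤s i≤n)))))
                           (+-identityˡ _)
  ... | no s≢1+n = trans (+-cong (∑-single n s f (ℕₚ.≤-pred (ℕₚ.≤∧≢⇒< s≤1+n s≢1+n))
                                               (λ i i≤n → f≈0 i (ℕₚ.m≤n⇒m≤1+n i≤n)))
                                 (f≈0 (suc n) ℕₚ.≤-refl (s≢1+n ∘ ≡.sym)))
                         (+-identityʳ _)

  ∑-triangle : ∀ a (H : ℕ → ℕ → Carrier) →
    ∑≤ a (λ i → ∑≤ i (λ j → H i j)) ≈ ∑≤ a (λ j → ∑≤ (a ∸ j) (λ d → H (j ℕ.+ d) j))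
  ∑-triangle zero H = refl
  ∑-triangle (suc a) H = begin
    ∑≤ a (λ i → ∑≤ i (H i)) + (∑≤ a (H (suc a)) + H (suc a) (suc a))
      ≈⟨ +-congʳ (∑-triangle a H) ⟩
    ∑≤ a (λ j → column a j) + (∑≤ a (H (suc a)) + H (suc a) (suc a))
      ≈⟨ +-assoc _ _ _ ⟨
    (∑≤ a (λ j → column a j) + ∑≤ a (H (suc a))) + H (suc a) (suc a)
      ≈⟨ +-congʳ (∑-distrib-+ a _ _) ⟨
    ∑≤ a (λ j → column a j + H (suc a) j) + H (suc a) (suc a)
      ≈⟨ +-cong (∑-cong a (λ j j≤a → sym (column-suc j j≤a)))
                (reflexive (≡.cong (λ k → H k (suc a)) (≡.sym (ℕₚ.+-identityʳ (suc a))))) ⟩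
    ∑≤ a (λ j → column (suc a) j) + H (suc a ℕ.+ 0) (suc a)
      ≈⟨ +-congˡ (reflexive (≡.cong (λ k → ∑≤ k (λ d → H (suc a ℕ.+ d) (suc a))) (ℕₚ.n∸n≡0 a))) ⟨
    ∑≤ a (λ j → column (suc a) j) + column (suc a) (suc a) ∎
    where
    column : ℕ → ℕ → Carrier
    column b j = ∑≤ (b ∸ j) (λ d → H (j ℕ.+ d) j)
    column-suc : ∀ j → j ≤ a → column (suc a) j ≈ column a j + H (suc a) j
    column-suc j j≤a rewrite ℕₚ.+-∸-assoc 1 j≤a =
      +-congˡ (reflexive (≡.cong (λ k → H k j) (≡.trans (ℕₚ.+-suc j (a ∸ j)) (≡.cong suc (ℕₚ.m+[n∸m]≡n j≤a)))))

  Series : Set c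
  Series = ℕ → Carrier

  -- A record rather than a Π-type, so that both sides can be inferred from an equation.
  infix 4 _≋_
  record _≋_ (f g : Series) : Set ℓ where
    constructor coeffwise
    field coeff : ∀ n → f n ≈ g n
  open _≋_ public

  infixl 6 _⊕_
  infixl 7 _⊗_

  _⊕_ : Series → Series → Series
  (f ⊕ g) n = f n + g n

  ⊝_ : Series → Series
  (⊝ f) n = - f n

  𝟘 : Series
  𝟘 n = 0#

  𝟙 : Series
  𝟙 zero = 1#
  𝟙 (suc n) = 0#

  _⊗_ : Series → Series → Series
  (f ⊗ g) n = ∑≤ n (λ i → f i * g (n ∸ i))

  ⊗-cong : ∀ {f f′ g g′} → f ≋ f′ → g ≋ g′ → f ⊗ g ≋ f′ ⊗ g′
  ⊗-cong f≋f′ g≋g′ = coeffwise λ n → ∑-cong n (λ i _ → *-cong (coeff f≋f′ i) (coeff g≋g′ (n ∸ i)))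

  ⊗-comm : ∀ f g → f ⊗ g ≋ g ⊗ f
  ⊗-comm f g = coeffwise λ n → trans (∑-reverse n _) (∑-cong n (λ i i≤n →
    trans (*-comm _ _) (*-congʳ (reflexive (≡.cong g (ℕₚ.m∸[m∸n]≡n i≤n))))))

  ⊗-identityˡ : ∀ f → 𝟙 ⊗ f ≋ f
  ⊗-identityˡ f = coeffwise λ n → trans (∑-single n 0 _ z≤n (vanish n)) (*-identityˡ _)
    where
    vanish : ∀ n i → i ≤ n → i ≢ 0 → 𝟙 i * f (n ∸ i) ≈ 0#
    vanish n zero _ 0≢0 = ⊥-elim (0≢0 ≡.refl)
    vanish n (suc i) _ _ = zeroˡ _

  ⊗-distribʳ : ∀ f g h → (f ⊕ g) ⊗ h ≋ f ⊗ h ⊕ g ⊗ h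
  ⊗-distribʳ f g h = coeffwise λ n → trans (∑-cong n (λ i _ → distribʳ _ _ _)) (∑-distrib-+ n _ _)

  ⊗-assoc : ∀ f g h → (f ⊗ g) ⊗ h ≋ f ⊗ (g ⊗ h)
  ⊗-assoc f g h = coeffwise λ n → begin
    ∑≤ n (λ i → ∑≤ i (λ j → f j * g (i ∸ j)) * h (n ∸ i))
      ≈⟨ ∑-cong n (λ i _ → *-distribʳ-∑ i _ _) ⟩
    ∑≤ n (λ i → ∑≤ i (λ j → f j * g (i ∸ j) * h (n ∸ i)))
      ≈⟨ ∑-triangle n (λ i j → f j * g (i ∸ j) * h (n ∸ i)) ⟩
    ∑≤ n (λ j → ∑≤ (n ∸ j) (λ d → f j * g ((j ℕ.+ d) ∸ j) * h (n ∸ (j ℕ.+ d))))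
      ≈⟨ ∑-cong n (λ j _ → ∑-cong (n ∸ j) (λ d _ → trans (*-assoc _ _ _)
           (*-congˡ (*-cong (reflexive (≡.cong g (ℕₚ.m+n∸m≡n j d)))
                            (reflexive (≡.cong h (≡.sym (ℕₚ.∸-+-assoc n j d)))))))) ⟩
    ∑≤ n (λ j → ∑≤ (n ∸ j) (λ d → f j * (g d * h ((n ∸ j) ∸ d))))
      ≈⟨ ∑-cong n (λ j _ → *-distribˡ-∑ (n ∸ j) _ _) ⟨
    ∑≤ n (λ j → f j * ∑≤ (n ∸ j) (λ d → g d * h ((n ∸ j) ∸ d))) ∎

  seriesRing : CommutativeRing c ℓ
  seriesRing = record
    { Carrier = Series ; _≈_ = _≋_ ; _+_ = _⊕_ ; _*_ = _⊗_ ; -_ = ⊝_ ; 0# = 𝟘 ; 1# = 𝟙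
    ; isCommutativeRing = record
      { isRing = record
        { +-isAbelianGroup = record
          { isGroup = record
            { isMonoid = record
              { isSemigroup = record
                { isMagma = record { isEquivalence = ≋-isEquivalence ; ∙-cong = λ p q → coeffwise λ n → +-cong (coeff p n) (coeff q n) }
                ; assoc = λ f g h → coeffwise λ n → +-assoc _ _ _ }
              ; identity = (λ f → coeffwise λ n → +-identityˡ _) , (λ f → coeffwise λ n → +-identityʳ _) }
            ; inverse = (λ f → coeffwise λ n → -‿inverseˡ _) , (λ f → coeffwise λ n → -‿inverseʳ _)
            ; ⁻¹-cong = λ p → coeffwise λ n → -‿cong (coeff p n) }
          ; comm = λ f g → coeffwise λ n → +-comm _ _ }
        ; *-cong = ⊗-cong
        ; *-assoc = ⊗-assoc
        ; *-identity = ⊗-identityˡ , (λ f → ≋-trans (⊗-comm f 𝟙) (⊗-identityˡ f))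
        ; distrib = (λ f g h → ≋-trans (⊗-comm f (g ⊕ h)) (≋-trans (⊗-distribʳ g h f)
                                 (coeffwise λ n → +-cong (coeff (⊗-comm g f) n) (coeff (⊗-comm h f) n))))
                  , (λ h f g → ⊗-distribʳ f g h) }
      ; *-comm = ⊗-comm } }
    where
    ≋-trans : ∀ {f g h} → f ≋ g → g ≋ h → f ≋ h
    ≋-trans p q = coeffwise λ n → trans (coeff p n) (coeff q n)
    ≋-isEquivalence : IsEquivalence _≋_
    ≋-isEquivalence = record { refl = coeffwise λ n → refl ; sym = λ p → coeffwise λ n → sym (coeff p n) ; trans = ≋-trans }

  monomial : ℕ → Carrier → Series
  monomial s x n with n ℕ.≟ s
  ... | yes _ = x
  ... | no _ = 0#

  monomial-⊗ : ∀ s x f n → s ≤ n → (monomial s x ⊗ f) n ≈ x * f (n ∸ s)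
  monomial-⊗ s x f n s≤n = trans (∑-single n s _ s≤n (λ i _ → off i)) on
    where
    off : ∀ i → i ≢ s → monomial s x i * f (n ∸ i) ≈ 0#
    off i i≢s with i ℕ.≟ s
    ... | yes i≡s = ⊥-elim (i≢s i≡s)
    ... | no _ = zeroˡ _
    on : monomial s x s * f (n ∸ s) ≈ x * f (n ∸ s)
    on with s ℕ.≟ s
    ... | yes _ = refl
    ... | no s≢s = ⊥-elim (s≢s ≡.refl)

  monomial-⊗-< : ∀ s x f n → n < s → (monomial s x ⊗ f) n ≈ 0#
  monomial-⊗-< s x f n n<s = ∑-zero n _ (λ i i≤n → off i (λ { ≡.refl → ℕₚ.<-irrefl ≡.refl (ℕₚ.≤-<-trans i≤n n<s) }))
    where
    off : ∀ i → i ≢ s → monomial s x i * f (n ∸ i) ≈ 0#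
    off i i≢s with i ℕ.≟ s
    ... | yes i≡s = ⊥-elim (i≢s i≡s)
    ... | no _ = zeroˡ _

  monomial-cong : ∀ s {x y} → x ≈ y → monomial s x ≋ monomial s y
  monomial-cong s x≈y = coeffwise at
    where
    at : ∀ n → monomial s _ n ≈ monomial s _ n
    at n with n ℕ.≟ s
    ... | yes _ = x≈y
    ... | no _ = refl

  monomial-0-1 : monomial 0 1# ≋ 𝟙
  monomial-0-1 = coeffwise λ { zero → refl ; (suc n) → refl }

  monomial-+ : ∀ s t x y → monomial (s ℕ.+ t) (x * y) ≋ monomial s x ⊗ monomial t y
  monomial-+ s t x y = coeffwise at
    where
    at : ∀ n → monomial (s ℕ.+ t) (x * y) n ≈ (monomial s x ⊗ monomial t y) n
    at n with s ℕ.≤? n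
    ... | no s≰n = sym (trans (monomial-⊗-< s x (monomial t y) n (ℕₚ.≰⇒> s≰n)) (sym beyond))
      where
      beyond : monomial (s ℕ.+ t) (x * y) n ≈ 0#
      beyond with n ℕ.≟ s ℕ.+ t
      ... | yes ≡.refl = ⊥-elim (s≰n (ℕₚ.m≤m+n s t))
      ... | no _ = refl
    ... | yes s≤n = sym (trans (monomial-⊗ s x (monomial t y) n s≤n) within)
      where
      within : x * monomial t y (n ∸ s) ≈ monomial (s ℕ.+ t) (x * y) n
      within with n ∸ s ℕ.≟ t | n ℕ.≟ s ℕ.+ t
      ... | yes _ | yes _ = refl
      ... | no _ | no _ = zeroʳ x
      ... | yes e | no ne = ⊥-elim (ne (≡.trans (≡.sym (ℕₚ.m+[n∸m]≡n s≤n)) (≡.cong (s ℕ.+_) e)))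
      ... | no ne | yes ≡.refl = ⊥-elim (ne (ℕₚ.m+n∸m≡n s t))

  -- For M a monoid morphism (ℕ, +) → (R, *), twisting is the substitution X ↦ M 1 · X.
  module Twist (M : ℕ → Carrier) (M-0 : M 0 ≈ 1#) (M-+ : ∀ i j → M (i ℕ.+ j) ≈ M i * M j) where

    twist : Series → Series
    twist f n = M n * f n

    twist-cong : ∀ {f g} → f ≋ g → twist f ≋ twist g
    twist-cong f≋g = coeffwise λ n → *-congˡ (coeff f≋g n)

    twist-⊕ : ∀ f g → twist (f ⊕ g) ≋ twist f ⊕ twist g
    twist-⊕ f g = coeffwise λ n → distribˡ _ _ _

    twist-⊗ : ∀ f g → twist (f ⊗ g) ≋ twist f ⊗ twist g
    twist-⊗ f g = coeffwise λ n → trans (*-distribˡ-∑ n _ _) (∑-cong n (λ i i≤n → begin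
      M n * (f i * g (n ∸ i))
        ≈⟨ *-congʳ (reflexive (≡.cong M (≡.sym (ℕₚ.m+[n∸m]≡n i≤n)))) ⟩
      M (i ℕ.+ (n ∸ i)) * (f i * g (n ∸ i))
        ≈⟨ *-congʳ (M-+ i (n ∸ i)) ⟩
      (M i * M (n ∸ i)) * (f i * g (n ∸ i))
        ≈⟨ *-interchange _ _ _ _ ⟩
      (M i * f i) * (M (n ∸ i) * g (n ∸ i)) ∎))

    twist-𝟙 : twist 𝟙 ≋ 𝟙
    twist-𝟙 = coeffwise λ { zero → trans (*-congʳ M-0) (*-identityˡ _) ; (suc n) → zeroʳ _ }

  module Coefficientwise (φ : Carrier → Carrier) (φ-cong : ∀ {x y} → x ≈ y → φ x ≈ φ y)
                         (φ-+ : ∀ x y → φ (x + y) ≈ φ x + φ y) (φ-* : ∀ x y → φ (x * y) ≈ φ x * φ y)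
                         (φ-1 : φ 1# ≈ 1#) where

    φ-0 : φ 0# ≈ 0#
    φ-0 = x+x≈x⇒x≈0 (φ 0#) (trans (sym (φ-+ 0# 0#)) (φ-cong (+-identityʳ 0#)))
      where open import Algebra.Properties.Ring ring using (x+x≈x⇒x≈0)

    φ-∑ : ∀ n f → φ (∑≤ n f) ≈ ∑≤ n (λ i → φ (f i))
    φ-∑ zero f = refl
    φ-∑ (suc n) f = trans (φ-+ _ _) (+-congʳ (φ-∑ n f))

    mapCoeffs : Series → Series
    mapCoeffs f n = φ (f n)

    mapCoeffs-⊗ : ∀ f g → mapCoeffs (f ⊗ g) ≋ mapCoeffs f ⊗ mapCoeffs g
    mapCoeffs-⊗ f g = coeffwise λ n → trans (φ-∑ n _) (∑-cong n (λ i _ → φ-* _ _))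

    mapCoeffs-𝟙 : mapCoeffs 𝟙 ≋ 𝟙
    mapCoeffs-𝟙 = coeffwise λ { zero → φ-1 ; (suc n) → φ-0 }

open import Defs

-- Defs' Series a b n is the coefficient of xᵃ yᵇ qⁿ, so Series is the carrier of ℤ⟦q⟧⟦y⟧⟦x⟧.
module ℤ⟦q⟧ = PowerSeries ℤₚ.+-*-commutativeRing
module ℤ⟦q,y⟧ = PowerSeries ℤ⟦q⟧.seriesRing
module ℤ⟦q,y,x⟧ = PowerSeries ℤ⟦q,y⟧.seriesRing

open ℤ⟦q,y,x⟧ using (_≋_; _⊗_; _⊕_; ⊝_; 𝟙)

⌊≟⌋-true : ∀ {x y} → x ≡ y → ⌊ x ℕ.≟ y ⌋ ≡ true
⌊≟⌋-true {x} {y} x≡y = ≡.trans (isYes≗does (x ℕ.≟ y)) (dec-true (x ℕ.≟ y) x≡y)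

⌊≟⌋-false : ∀ {x y} → x ≢ y → ⌊ x ℕ.≟ y ⌋ ≡ false
⌊≟⌋-false {x} {y} x≢y = ≡.trans (isYes≗does (x ℕ.≟ y)) (dec-false (x ℕ.≟ y) x≢y)

infix 4 _≐_
_≐_ : Series → Series → Set
P ≐ Q = ∀ a b n → P a b n ≡ Q a b n

≐⇒≋ : ∀ {P Q} → P ≐ Q → P ≋ Q
≐⇒≋ P≐Q = ℤ⟦q,y,x⟧.coeffwise λ a → ℤ⟦q,y⟧.coeffwise λ b → ℤ⟦q⟧.coeffwise λ n → P≐Q a b n

≋⇒≐ : ∀ {P Q} → P ≋ Q → P ≐ Q
≋⇒≐ P≋Q a b n = ℤ⟦q⟧.coeff (ℤ⟦q,y⟧.coeff (ℤ⟦q,y,x⟧.coeff P≋Q a) b) n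

sumTo-cong : ∀ n {f g : ℕ → ℤ} → (∀ i → i ≤ n → f i ≡ g i) → sumTo n f ≡ sumTo n g
sumTo-cong zero f≡g = f≡g 0 z≤n
sumTo-cong (suc n) f≡g = ≡.cong₂ ℤ._+_ (sumTo-cong n (λ i i≤n → f≡g i (ℕₚ.m≤n⇒m≤1+n i≤n))) (f≡g (suc n) ℕₚ.≤-refl)

sumTo≡ℤ⟦q⟧ : ∀ n f → ℤ⟦q⟧.∑≤ n f ≡ sumTo n f
sumTo≡ℤ⟦q⟧ zero f = ≡.refl
sumTo≡ℤ⟦q⟧ (suc n) f = ≡.cong (ℤ._+ f (suc n)) (sumTo≡ℤ⟦q⟧ n f)

sumTo≡ℤ⟦q,y⟧ : ∀ b (h : ℕ → ℕ → ℤ) n → ℤ⟦q,y⟧.∑≤ b h n ≡ sumTo b (λ j → h j n)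
sumTo≡ℤ⟦q,y⟧ zero h n = ≡.refl
sumTo≡ℤ⟦q,y⟧ (suc b) h n = ≡.cong (ℤ._+ h (suc b) n) (sumTo≡ℤ⟦q,y⟧ b h n)

sumTo≡ℤ⟦q,y,x⟧ : ∀ a (h : ℕ → ℕ → ℕ → ℤ) b n → ℤ⟦q,y,x⟧.∑≤ a h b n ≡ sumTo a (λ i → h i b n)
sumTo≡ℤ⟦q,y,x⟧ zero h b n = ≡.refl
sumTo≡ℤ⟦q,y,x⟧ (suc a) h b n = ≡.cong (ℤ._+ h (suc a) b n) (sumTo≡ℤ⟦q,y,x⟧ a h b n)

⊛≋⊗ : ∀ f g → f ⊛ g ≋ f ⊗ g
⊛≋⊗ f g = ≐⇒≋ λ a b n → ≡.sym (≡.trans (sumTo≡ℤ⟦q,y,x⟧ a _ b n) (sumTo-cong a (λ i _ →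
  ≡.trans (sumTo≡ℤ⟦q,y⟧ b _ n) (sumTo-cong b (λ j _ → sumTo≡ℤ⟦q⟧ n _)))))

oneS≋𝟙 : oneS ≋ 𝟙
oneS≋𝟙 = ≐⇒≋ oneS≐𝟙
  where
  oneS≐𝟙 : oneS ≐ 𝟙
  oneS≐𝟙 zero zero zero = ≡.refl
  oneS≐𝟙 zero zero (suc n) = ≡.refl
  oneS≐𝟙 zero (suc b) n = ≡.refl
  oneS≐𝟙 (suc a) b n = ≡.refl

module ℤ⟦q⟧ʳ = CommutativeRing ℤ⟦q⟧.seriesRing
module ℤ⟦q,y⟧ʳ = CommutativeRing ℤ⟦q,y⟧.seriesRing
module 𝕊 = CommutativeRing ℤ⟦q,y,x⟧.seriesRing
open import Relation.Binary.Reasoning.Setoid 𝕊.setoid as ≋-Reasoning using ()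
open import Algebra.Properties.Ring 𝕊.ring using (-‿distribʳ-*)
open import Algebra.Properties.CommutativeSemigroup 𝕊.*-commutativeSemigroup using (xy∙z≈y∙xz)

-- Finite and infinite products

∏< : (ℕ → Series) → ℕ → Series
∏< F zero = 𝟙
∏< F (suc N) = F 0 ⊗ ∏< (F ∘ suc) N

∏<-cong : ∀ {F G} → (∀ t → F t ≋ G t) → ∀ N → ∏< F N ≋ ∏< G N
∏<-cong F≋G zero = 𝕊.refl
∏<-cong F≋G (suc N) = 𝕊.*-cong (F≋G 0) (∏<-cong (F≋G ∘ suc) N)

∏<-+ : ∀ p e F → ∏< F (p ℕ.+ e) ≋ ∏< F p ⊗ ∏< (λ t → F (p ℕ.+ t)) e
∏<-+ zero e F = 𝕊.sym (𝕊.*-identityˡ (∏< F e))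
∏<-+ (suc p) e F = 𝕊.trans (𝕊.*-congˡ {F 0} (∏<-+ p e (F ∘ suc)))
  (𝕊.sym (𝕊.*-assoc (F 0) (∏< (F ∘ suc) p) (∏< (λ t → F (suc p ℕ.+ t)) e)))

prodList-applyUpTo : ∀ (F : ℕ → Series) g N → prodList (map F (applyUpTo g N)) ≋ ∏< (F ∘ g) N
prodList-applyUpTo F g zero = oneS≋𝟙
prodList-applyUpTo F g (suc N) = 𝕊.trans (⊛≋⊗ (F (g 0)) (prodList (map F (applyUpTo (g ∘ suc) N))))
  (𝕊.*-congˡ {F (g 0)} (prodList-applyUpTo F (g ∘ suc) N))

infProd≡∏< : ∀ F a b n → infProd F a b n ≡ ∏< F (suc n) a b n
infProd≡∏< F a b n = ≋⇒≐ (prodList-applyUpTo F id (suc n)) a b n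

infProd-cong : ∀ {F G} → (∀ t → F t ≋ G t) → infProd F ≋ infProd G
infProd-cong {F} {G} F≋G = ≐⇒≋ λ a b n →
  ≡.trans (infProd≡∏< F a b n) (≡.trans (≋⇒≐ (∏<-cong F≋G (suc n)) a b n) (≡.sym (infProd≡∏< G a b n)))

infix 4 _≈[_]_
record _≈[_]_ (P : Series) (d : ℕ) (Q : Series) : Set where
  constructor agreeUpTo
  field agree : ∀ a b k → k ≤ d → P a b k ≡ Q a b k
open _≈[_]_

≈[]-trans : ∀ {P Q R} d → P ≈[ d ] Q → Q ≈[ d ] R → P ≈[ d ] R
≈[]-trans d P≈Q Q≈R = agreeUpTo λ a b k k≤d → ≡.trans (agree P≈Q a b k k≤d) (agree Q≈R a b k k≤d)

≋⇒≈[] : ∀ {P Q} d → P ≋ Q → P ≈[ d ] Q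
≋⇒≈[] d P≋Q = agreeUpTo λ a b k _ → ≋⇒≐ P≋Q a b k

≈[]-weaken : ∀ {P Q} {d e} → e ≤ d → P ≈[ d ] Q → P ≈[ e ] Q
≈[]-weaken e≤d P≈Q = agreeUpTo λ a b k k≤e → agree P≈Q a b k (ℕₚ.≤-trans k≤e e≤d)

⊗-≈[] : ∀ {P P′ Q Q′} d → P ≈[ d ] P′ → Q ≈[ d ] Q′ → P ⊗ Q ≈[ d ] P′ ⊗ Q′
⊗-≈[] {P} {P′} {Q} {Q′} d P≈P′ Q≈Q′ = agreeUpTo λ a b k k≤d →
  ≡.trans (≡.sym (≋⇒≐ (⊛≋⊗ P Q) a b k)) (≡.trans (⊛-≈[] a b k k≤d) (≋⇒≐ (⊛≋⊗ P′ Q′) a b k))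
  where
  ⊛-≈[] : ∀ a b k → k ≤ d → (P ⊛ Q) a b k ≡ (P′ ⊛ Q′) a b k
  ⊛-≈[] a b k k≤d = sumTo-cong a (λ i _ → sumTo-cong b (λ j _ → sumTo-cong k (λ l l≤k →
    ≡.cong₂ ℤ._*_ (agree P≈P′ i j l (ℕₚ.≤-trans l≤k k≤d))
                  (agree Q≈Q′ (a ∸ i) (b ∸ j) (k ∸ l) (ℕₚ.≤-trans (ℕₚ.m∸n≤m k l) k≤d)))))

∏<-≈[]-𝟙 : ∀ d F → (∀ t → F t ≈[ d ] 𝟙) → ∀ N → ∏< F N ≈[ d ] 𝟙
∏<-≈[]-𝟙 d F F≈𝟙 zero = ≋⇒≈[] d 𝕊.refl
∏<-≈[]-𝟙 d F F≈𝟙 (suc N) =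
  ≈[]-trans d (⊗-≈[] d (F≈𝟙 0) (∏<-≈[]-𝟙 d (F ∘ suc) (F≈𝟙 ∘ suc) N)) (≋⇒≈[] d (𝕊.*-identityˡ 𝟙))

∏<-stable : ∀ d F N₀ → (∀ t → N₀ ≤ t → F t ≈[ d ] 𝟙) → ∀ e → ∏< F (N₀ ℕ.+ e) ≈[ d ] ∏< F N₀
∏<-stable d F N₀ F≈𝟙 e =
  ≈[]-trans d (≋⇒≈[] d (∏<-+ N₀ e F))
    (≈[]-trans d (⊗-≈[] d (≋⇒≈[] d (𝕊.refl {∏< F N₀})) (∏<-≈[]-𝟙 d (λ t → F (N₀ ℕ.+ t)) (λ t → F≈𝟙 (N₀ ℕ.+ t) (ℕₚ.m≤m+n N₀ t)) e))
      (≋⇒≈[] d (𝕊.*-identityʳ (∏< F N₀))))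

infProd-∏< : ∀ F k → (∀ t → k ≤ t → F t ≈[ k ] 𝟙) → ∀ N a b → k ≤ N → infProd F a b k ≡ ∏< F N a b k
infProd-∏< F k F≈𝟙 N a b k≤N = ≡.trans (infProd≡∏< F a b k)
  (≡.trans (stable-at (ℕₚ.+-comm k 1)) (≡.sym (stable-at (proj₂ (ℕₚ.m≤n⇒∃[o]m+o≡n k≤N)))))
  where
  stable-at : ∀ {e M} → k ℕ.+ e ≡ M → ∏< F M a b k ≡ ∏< F k a b k
  stable-at {e} ≡.refl = agree (∏<-stable k F k F≈𝟙 e) a b k ℕₚ.≤-refl

-- F j ≡ 1 mod q^(j+1): then truncating infProd F at the q-degree, as Defs does, is exact.
ConvergentFactors : (ℕ → Series) → Set
ConvergentFactors F = ∀ j → F j ≈[ j ] 𝟙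

infProd-unfold : ∀ F → ConvergentFactors F → infProd F ≋ F 0 ⊗ infProd (F ∘ suc)
infProd-unfold F conv = ≐⇒≋ λ a b n → ≡.trans (infProd≡∏< F a b n)
  (agree (⊗-≈[] n (≋⇒≈[] n (𝕊.refl {F 0})) (tail≈ n)) a b n ℕₚ.≤-refl)
  where
  tail≈ : ∀ n → ∏< (F ∘ suc) n ≈[ n ] infProd (F ∘ suc)
  tail≈ n = agreeUpTo λ a′ b′ k k≤n → ≡.sym (infProd-∏< (F ∘ suc) k
    (λ t k≤t → ≈[]-weaken (ℕₚ.m≤n⇒m≤1+n k≤t) (conv (suc t))) n a′ b′ k≤n)

infixr 8 q^_·_
q^_·_ : ℕ → (ℕ → ℤ) → ℕ → ℤ
(q^ v · h) n with v ℕ.≤? n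
... | yes _ = h (n ∸ v)
... | no _ = + 0

q^·-≤ : ∀ {v n} h → v ≤ n → (q^ v · h) n ≡ h (n ∸ v)
q^·-≤ {v} {n} h v≤n with v ℕ.≤? n
... | yes _ = ≡.refl
... | no v≰n = ⊥-elim (v≰n v≤n)

q^·-> : ∀ {v n} h → ¬ v ≤ n → (q^ v · h) n ≡ + 0
q^·-> {v} {n} h v≰n with v ℕ.≤? n
... | yes v≤n = ⊥-elim (v≰n v≤n)
... | no _ = ≡.refl

q^·-cong : ∀ v n {h h′} → (∀ k → k ≤ n → h k ≡ h′ k) → (q^ v · h) n ≡ (q^ v · h′) n
q^·-cong v n h≡h′ with v ℕ.≤? n
... | yes _ = h≡h′ _ (ℕₚ.m∸n≤m n v)
... | no _ = ≡.refl

q^·-cong-< : ∀ {v} n {h h′} → 0 < v → (∀ k → k < n → h k ≡ h′ k) → (q^ v · h) n ≡ (q^ v · h′) n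
q^·-cong-< {v} n 0<v h≡h′ with v ℕ.≤? n
... | yes v≤n = h≡h′ _ (ℕₚ.∸-monoʳ-< 0<v v≤n)
... | no _ = ≡.refl

q^·-zero : ∀ v n → (q^ v · (λ _ → + 0)) n ≡ + 0
q^·-zero v n with v ℕ.≤? n
... | yes _ = ≡.refl
... | no _ = ≡.refl

q^·-distrib-+ : ∀ v n (h h′ : ℕ → ℤ) → (q^ v · (λ k → h k ℤ.+ h′ k)) n ≡ (q^ v · h) n ℤ.+ (q^ v · h′) n
q^·-distrib-+ v n h h′ with v ℕ.≤? n
... | yes _ = ≡.refl
... | no _ = ≡.refl

q^·-q^· : ∀ u v n (h : ℕ → ℤ) → (q^ u · q^ v · h) n ≡ (q^ (u ℕ.+ v) · h) n
q^·-q^· u v n h with u ℕ.≤? n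
... | no u≰n = ≡.sym (q^·-> h (λ u+v≤n → u≰n (ℕₚ.≤-trans (ℕₚ.m≤m+n u v) u+v≤n)))
... | yes u≤n with v ℕ.≤? n ∸ u
...   | yes v≤n∸u = ≡.sym (≡.trans (q^·-≤ h (≡.subst (u ℕ.+ v ≤_) (ℕₚ.m+[n∸m]≡n u≤n) (ℕₚ.+-monoʳ-≤ u v≤n∸u)))
                                   (≡.cong h (≡.sym (ℕₚ.∸-+-assoc n u v))))
...   | no v≰n∸u = ≡.sym (q^·-> h (λ u+v≤n → v≰n∸u (≡.subst (_≤ n ∸ u) (ℕₚ.m+n∸m≡n u v) (ℕₚ.∸-monoˡ-≤ u u+v≤n))))

q^·-indicator : ∀ (g : Bool → ℤ) → g false ≡ + 0 → ∀ v s n →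
  (q^ s · (λ k → g ⌊ k ℕ.≟ v ⌋)) n ≡ g ⌊ n ℕ.≟ v ℕ.+ s ⌋
q^·-indicator g g-false v s n with s ℕ.≤? n
... | yes s≤n = ≡.cong g (same (n ∸ s ℕ.≟ v) (n ℕ.≟ v ℕ.+ s))
  where
  same : (p : Dec (n ∸ s ≡ v)) (q : Dec (n ≡ v ℕ.+ s)) → ⌊ p ⌋ ≡ ⌊ q ⌋
  same (yes _) (yes _) = ≡.refl
  same (no _) (no _) = ≡.refl
  same (yes ≡.refl) (no n≢) = ⊥-elim (n≢ (≡.sym (ℕₚ.m∸n+n≡m s≤n)))
  same (no n∸s≢) (yes ≡.refl) = ⊥-elim (n∸s≢ (ℕₚ.m+n∸n≡m v s))
... | no s≰n = ≡.sym (≡.trans (≡.cong g (⌊≟⌋-false (λ { ≡.refl → s≰n (ℕₚ.m≤n+m s v) }))) g-false)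

scaleBy : (ℕ → ℕ → ℕ) → Series → Series
scaleBy c P a b = q^ c a b · P a b

scaleBy-cong : ∀ c {P Q} → P ≋ Q → scaleBy c P ≋ scaleBy c Q
scaleBy-cong c P≋Q = ≐⇒≋ λ a b n → q^·-cong (c a b) n (λ k _ → ≋⇒≐ P≋Q a b k)

module ScaleByProducts (c : ℕ → ℕ → ℕ)
    (scale-⊗ : ∀ P Q → scaleBy c (P ⊗ Q) ≋ scaleBy c P ⊗ scaleBy c Q) (scale-𝟙 : scaleBy c 𝟙 ≋ 𝟙) where

  scaleBy-∏< : ∀ F N → scaleBy c (∏< F N) ≋ ∏< (scaleBy c ∘ F) N
  scaleBy-∏< F zero = scale-𝟙
  scaleBy-∏< F (suc N) =
    𝕊.trans (scale-⊗ (F 0) (∏< (F ∘ suc) N)) (𝕊.*-congˡ {scaleBy c (F 0)} (scaleBy-∏< (F ∘ suc) N))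

  scaleBy-infProd : ∀ F → ConvergentFactors F → scaleBy c (infProd F) ≋ infProd (scaleBy c ∘ F)
  scaleBy-infProd F conv = ≐⇒≋ λ a b n → ≡.sym (≡.trans (infProd≡∏< (scaleBy c ∘ F) a b n)
    (≡.trans (≡.sym (≋⇒≐ (scaleBy-∏< F (suc n)) a b n)) (q^·-cong (c a b) n (λ k k≤n →
      ≡.sym (infProd-∏< F k (λ t k≤t → ≈[]-weaken k≤t (conv t)) (suc n) a b (ℕₚ.m≤n⇒m≤1+n k≤n))))))

qᵏ : ℕ → ℤ⟦q⟧.Series
qᵏ k = ℤ⟦q⟧.monomial k (+ 1)

qᵏ-0 : qᵏ 0 ℤ⟦q⟧.≋ ℤ⟦q⟧.𝟙
qᵏ-0 = ℤ⟦q⟧.monomial-0-1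

qᵏ-* : ∀ m i j → qᵏ (m ℕ.* (i ℕ.+ j)) ℤ⟦q⟧.≋ qᵏ (m ℕ.* i) ℤ⟦q⟧.⊗ qᵏ (m ℕ.* j)
qᵏ-* m i j rewrite ℕₚ.*-distribˡ-+ m i j = ℤ⟦q⟧.monomial-+ (m ℕ.* i) (m ℕ.* j) (+ 1) (+ 1)

qᵏ-⊗ : ∀ k f n → (qᵏ k ℤ⟦q⟧.⊗ f) n ≡ (q^ k · f) n
qᵏ-⊗ k f n with k ℕ.≤? n
... | yes k≤n = ≡.trans (ℤ⟦q⟧.monomial-⊗ k (+ 1) f n k≤n) (ℤₚ.*-identityˡ _)
... | no k≰n = ℤ⟦q⟧.monomial-⊗-< k (+ 1) f n (ℕₚ.≰⇒> k≰n)

-- the substitutions x ↦ x qᵐ and y ↦ y qᵐ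
scaleX scaleY : ℕ → Series → Series
scaleX m = scaleBy (λ a _ → m ℕ.* a)
scaleY m = scaleBy (λ _ b → m ℕ.* b)

module ScaleX (m : ℕ) where

  private
    M : ℕ → ℤ⟦q,y⟧.Series
    M a = ℤ⟦q,y⟧.monomial 0 (qᵏ (m ℕ.* a))

    M-0 : M 0 ℤ⟦q,y⟧.≋ ℤ⟦q,y⟧.𝟙
    M-0 rewrite ℕₚ.*-zeroʳ m = ℤ⟦q,y⟧ʳ.trans (ℤ⟦q,y⟧.monomial-cong 0 qᵏ-0) ℤ⟦q,y⟧.monomial-0-1

    M-+ : ∀ i j → M (i ℕ.+ j) ℤ⟦q,y⟧.≋ M i ℤ⟦q,y⟧.⊗ M j
    M-+ i j = ℤ⟦q,y⟧ʳ.trans (ℤ⟦q,y⟧.monomial-cong 0 (qᵏ-* m i j))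
                (ℤ⟦q,y⟧.monomial-+ 0 0 (qᵏ (m ℕ.* i)) (qᵏ (m ℕ.* j)))

    open ℤ⟦q,y,x⟧.Twist M M-0 M-+

    twist≋scaleX : ∀ P → twist P ≋ scaleX m P
    twist≋scaleX P = ≐⇒≋ λ a b n →
      ≡.trans (ℤ⟦q⟧.coeff (ℤ⟦q,y⟧.monomial-⊗ 0 (qᵏ (m ℕ.* a)) (P a) b z≤n) n) (qᵏ-⊗ (m ℕ.* a) (P a b) n)

  scaleX-⊗ : ∀ P Q → scaleX m (P ⊗ Q) ≋ scaleX m P ⊗ scaleX m Q
  scaleX-⊗ P Q = 𝕊.trans (𝕊.sym (twist≋scaleX (P ⊗ Q)))
    (𝕊.trans (twist-⊗ P Q) (𝕊.*-cong (twist≋scaleX P) (twist≋scaleX Q)))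

  scaleX-𝟙 : scaleX m 𝟙 ≋ 𝟙
  scaleX-𝟙 = 𝕊.trans (𝕊.sym (twist≋scaleX 𝟙)) twist-𝟙

  open ScaleByProducts (λ a _ → m ℕ.* a) scaleX-⊗ scaleX-𝟙 public
    renaming (scaleBy-infProd to scaleX-infProd)

module ScaleY (m : ℕ) where

  private
    M : ℕ → ℤ⟦q⟧.Series
    M b = qᵏ (m ℕ.* b)

    M-0 : M 0 ℤ⟦q⟧.≋ ℤ⟦q⟧.𝟙
    M-0 rewrite ℕₚ.*-zeroʳ m = qᵏ-0

    module T = ℤ⟦q,y⟧.Twist M M-0 (qᵏ-* m)
    open ℤ⟦q,y,x⟧.Coefficientwise T.twist T.twist-cong T.twist-⊕ T.twist-⊗ T.twist-𝟙

    mapCoeffs≋scaleY : ∀ P → mapCoeffs P ≋ scaleY m P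
    mapCoeffs≋scaleY P = ≐⇒≋ λ a b n → qᵏ-⊗ (m ℕ.* b) (P a b) n

  scaleY-⊗ : ∀ P Q → scaleY m (P ⊗ Q) ≋ scaleY m P ⊗ scaleY m Q
  scaleY-⊗ P Q = 𝕊.trans (𝕊.sym (mapCoeffs≋scaleY (P ⊗ Q)))
    (𝕊.trans (mapCoeffs-⊗ P Q) (𝕊.*-cong (mapCoeffs≋scaleY P) (mapCoeffs≋scaleY Q)))

  scaleY-𝟙 : scaleY m 𝟙 ≋ 𝟙
  scaleY-𝟙 = 𝕊.trans (𝕊.sym (mapCoeffs≋scaleY 𝟙)) mapCoeffs-𝟙

  open ScaleByProducts (λ _ b → m ℕ.* b) scaleY-⊗ scaleY-𝟙 public
    renaming (scaleBy-infProd to scaleY-infProd)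

xyq : ℕ → ℕ → ℕ → Series
xyq i j k = ℤ⟦q,y,x⟧.monomial i (ℤ⟦q,y⟧.monomial j (qᵏ k))

xyq-⊗ : ∀ i j k P a b n →
  (xyq i j k ⊗ P) a b n ≡ (q^ i · (λ a′ → (q^ j · (λ b′ → (q^ k · P a′ b′) n)) b)) a
xyq-⊗ i j k P a b n = along-x-by (i ℕ.≤? a)
  where
  yq = ℤ⟦q,y⟧.monomial j (qᵏ k)
  along-x = λ a′ → (q^ j · (λ b′ → (q^ k · P a′ b′) n)) b
  along-y = λ b′ → (q^ k · P (a ∸ i) b′) n
  along-y-by : Dec (j ≤ b) → (yq ℤ⟦q,y⟧.⊗ P (a ∸ i)) b n ≡ (q^ j · along-y) b
  along-y-by (yes j≤b) = ≡.trans (ℤ⟦q⟧.coeff (ℤ⟦q,y⟧.monomial-⊗ j (qᵏ k) (P (a ∸ i)) b j≤b) n)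
    (≡.trans (qᵏ-⊗ k (P (a ∸ i) (b ∸ j)) n) (≡.sym (q^·-≤ along-y j≤b)))
  along-y-by (no j≰b) = ≡.trans (ℤ⟦q⟧.coeff (ℤ⟦q,y⟧.monomial-⊗-< j (qᵏ k) (P (a ∸ i)) b (ℕₚ.≰⇒> j≰b)) n)
    (≡.sym (q^·-> along-y j≰b))
  along-x-by : Dec (i ≤ a) → (xyq i j k ⊗ P) a b n ≡ (q^ i · along-x) a
  along-x-by (yes i≤a) = ≡.trans (ℤ⟦q⟧.coeff (ℤ⟦q,y⟧.coeff (ℤ⟦q,y,x⟧.monomial-⊗ i yq P a i≤a) b) n)
    (≡.trans (along-y-by (j ℕ.≤? b)) (≡.sym (q^·-≤ along-x i≤a)))
  along-x-by (no i≰a) = ≡.trans (ℤ⟦q⟧.coeff (ℤ⟦q,y⟧.coeff (ℤ⟦q,y,x⟧.monomial-⊗-< i yq P a (ℕₚ.≰⇒> i≰a)) b) n)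
    (≡.sym (q^·-> along-x i≰a))

oneMinus≋ : ∀ i j k → oneMinus i j k ≋ 𝟙 ⊕ ⊝ xyq i j k
oneMinus≋ i j k = ≐⇒≋ λ a b n → ≡.cong₂ ℤ._+_ (≋⇒≐ oneS≋𝟙 a b n) (≡.cong ℤ.-_ (indicator a b n))
  where
  indicator : ∀ a b n → [ ⌊ a ℕ.≟ i ⌋ ∧ (⌊ b ℕ.≟ j ⌋ ∧ ⌊ n ℕ.≟ k ⌋) ] ≡ xyq i j k a b n
  indicator a b n with a ℕ.≟ i
  ... | no _ = ≡.refl
  ... | yes _ with b ℕ.≟ j
  ...   | no _ = ≡.refl
  ...   | yes _ with n ℕ.≟ k
  ...     | no _ = ≡.refl
  ...     | yes _ = ≡.refl

⊗-oneMinus : ∀ P i j k a b n →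
  (P ⊗ oneMinus i j k) a b n ≡ P a b n ℤ.- (q^ i · (λ a′ → (q^ j · (λ b′ → (q^ k · P a′ b′) n)) b)) a
⊗-oneMinus P i j k a b n = ≡.trans (≋⇒≐ expand a b n) (≡.cong (λ t → P a b n ℤ.- t) (xyq-⊗ i j k P a b n))
  where
  open ≋-Reasoning
  expand : P ⊗ oneMinus i j k ≋ P ⊕ ⊝ (xyq i j k ⊗ P)
  expand = begin
    P ⊗ oneMinus i j k              ≈⟨ 𝕊.*-congˡ {P} (oneMinus≋ i j k) ⟩
    P ⊗ (𝟙 ⊕ ⊝ xyq i j k)           ≈⟨ 𝕊.distribˡ P 𝟙 (⊝ xyq i j k) ⟩
    P ⊗ 𝟙 ⊕ P ⊗ ⊝ xyq i j k         ≈⟨ 𝕊.+-cong (𝕊.*-identityʳ P) (𝕊.sym (-‿distribʳ-* P (xyq i j k))) ⟩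
    P ⊕ ⊝ (P ⊗ xyq i j k)           ≈⟨ 𝕊.+-congˡ {P} (𝕊.-‿cong (𝕊.*-comm P (xyq i j k))) ⟩
    P ⊕ ⊝ (xyq i j k ⊗ P)           ∎

geom-x : ∀ k → 1 ≤ k → ∀ a b n → geom 1 0 k a b n ≡ [ ⌊ b ℕ.≟ 0 ⌋ ∧ ⌊ n ℕ.≟ k ℕ.* a ⌋ ]
geom-x k 1≤k a b n with a ℕ.≤? n
... | yes a≤n = ≡.trans (≡.sym (sumTo≡ℤ⟦q⟧ n _)) (≡.trans
      (ℤ⟦q⟧.∑-single n a _ a≤n (λ t _ t≢a → off t (t≢a ∘ ≡.sym)))
      (≡.cong (λ z → [ z ∧ (⌊ b ℕ.≟ 0 ⌋ ∧ ⌊ n ℕ.≟ k ℕ.* a ⌋) ]) (⌊≟⌋-true (≡.sym (ℕₚ.*-identityˡ a)))))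
  where
  off : ∀ t → a ≢ t → [ ⌊ a ℕ.≟ 1 ℕ.* t ⌋ ∧ (⌊ b ℕ.≟ 0 ⌋ ∧ ⌊ n ℕ.≟ k ℕ.* t ⌋) ] ≡ + 0
  off t a≢t rewrite ℕₚ.*-identityˡ t | ⌊≟⌋-false a≢t = ≡.refl
... | no a≰n rewrite ⌊≟⌋-false {n} {k ℕ.* a} (λ { ≡.refl → a≰n (ℕₚ.m≤n*m a k {{ℕ.>-nonZero 1≤k}}) })
                   | ∧-zeroʳ ⌊ b ℕ.≟ 0 ⌋ =
  ≡.trans (≡.sym (sumTo≡ℤ⟦q⟧ n _)) (ℤ⟦q⟧.∑-zero n _ (λ t t≤n → off t (λ { ≡.refl → a≰n t≤n })))
  where
  off : ∀ t → a ≢ t → [ ⌊ a ℕ.≟ 1 ℕ.* t ⌋ ∧ (⌊ b ℕ.≟ 0 ⌋ ∧ ⌊ n ℕ.≟ k ℕ.* t ⌋) ] ≡ + 0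
  off t a≢t rewrite ℕₚ.*-identityˡ t | ⌊≟⌋-false a≢t = ≡.refl

geom-y : ∀ k → 1 ≤ k → ∀ a b n → geom 0 1 k a b n ≡ [ ⌊ a ℕ.≟ 0 ⌋ ∧ ⌊ n ℕ.≟ k ℕ.* b ⌋ ]
geom-y k 1≤k a b n with b ℕ.≤? n
... | yes b≤n = ≡.trans (≡.sym (sumTo≡ℤ⟦q⟧ n _)) (≡.trans
      (ℤ⟦q⟧.∑-single n b _ b≤n (λ t _ t≢b → off t (t≢b ∘ ≡.sym)))
      (≡.cong (λ z → [ ⌊ a ℕ.≟ 0 ⌋ ∧ (z ∧ ⌊ n ℕ.≟ k ℕ.* b ⌋) ]) (⌊≟⌋-true (≡.sym (ℕₚ.*-identityˡ b)))))
  where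
  off : ∀ t → b ≢ t → [ ⌊ a ℕ.≟ 0 ⌋ ∧ (⌊ b ℕ.≟ 1 ℕ.* t ⌋ ∧ ⌊ n ℕ.≟ k ℕ.* t ⌋) ] ≡ + 0
  off t b≢t rewrite ℕₚ.*-identityˡ t | ⌊≟⌋-false b≢t | ∧-zeroʳ ⌊ a ℕ.≟ 0 ⌋ = ≡.refl
... | no b≰n rewrite ⌊≟⌋-false {n} {k ℕ.* b} (λ { ≡.refl → b≰n (ℕₚ.m≤n*m b k {{ℕ.>-nonZero 1≤k}}) })
                   | ∧-zeroʳ ⌊ a ℕ.≟ 0 ⌋ =
  ≡.trans (≡.sym (sumTo≡ℤ⟦q⟧ n _)) (ℤ⟦q⟧.∑-zero n _ (λ t t≤n → off t (λ { ≡.refl → b≰n t≤n })))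
  where
  off : ∀ t → b ≢ t → [ ⌊ a ℕ.≟ 0 ⌋ ∧ (⌊ b ℕ.≟ 1 ℕ.* t ⌋ ∧ ⌊ n ℕ.≟ k ℕ.* t ⌋) ] ≡ + 0
  off t b≢t rewrite ℕₚ.*-identityˡ t | ⌊≟⌋-false b≢t | ∧-zeroʳ ⌊ a ℕ.≟ 0 ⌋ = ≡.refl

geom-x⊗oneMinus : ∀ k → 1 ≤ k → geom 1 0 k ⊗ oneMinus 1 0 k ≋ 𝟙
geom-x⊗oneMinus k 1≤k = ≐⇒≋ coeffs
  where
  coeffs : ∀ a b n → (geom 1 0 k ⊗ oneMinus 1 0 k) a b n ≡ 𝟙 a b n
  coeffs zero b n = ≡.trans (⊗-oneMinus (geom 1 0 k) 1 0 k 0 b n)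
    (≡.trans (ℤₚ.+-identityʳ _) (≡.trans (geom-x k 1≤k 0 b n)
    (≡.trans (≡.cong (λ e → [ ⌊ b ℕ.≟ 0 ⌋ ∧ ⌊ n ℕ.≟ e ⌋ ]) (ℕₚ.*-zeroʳ k)) (≋⇒≐ oneS≋𝟙 0 b n))))
  coeffs (suc a) b n = ≡.trans (⊗-oneMinus (geom 1 0 k) 1 0 k (suc a) b n)
    (≡.trans (≡.cong₂ ℤ._-_ (geom-x k 1≤k (suc a) b n) previous)
             (ℤₚ.+-inverseʳ [ ⌊ b ℕ.≟ 0 ⌋ ∧ ⌊ n ℕ.≟ k ℕ.* suc a ⌋ ]))
    where
    previous : (q^ k · (λ n′ → geom 1 0 k a b n′)) n ≡ [ ⌊ b ℕ.≟ 0 ⌋ ∧ ⌊ n ℕ.≟ k ℕ.* suc a ⌋ ]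
    previous = ≡.trans (q^·-cong k n (λ n′ _ → geom-x k 1≤k a b n′))
      (≡.trans (q^·-indicator (λ z → [ ⌊ b ℕ.≟ 0 ⌋ ∧ z ]) (≡.cong [_] (∧-zeroʳ ⌊ b ℕ.≟ 0 ⌋)) (k ℕ.* a) k n)
               (≡.cong (λ e → [ ⌊ b ℕ.≟ 0 ⌋ ∧ ⌊ n ℕ.≟ e ⌋ ]) (≡.trans (ℕₚ.+-comm (k ℕ.* a) k) (≡.sym (ℕₚ.*-suc k a)))))

geom-y⊗oneMinus : ∀ k → 1 ≤ k → geom 0 1 k ⊗ oneMinus 0 1 k ≋ 𝟙
geom-y⊗oneMinus k 1≤k = ≐⇒≋ coeffs
  where
  coeffs : ∀ a b n → (geom 0 1 k ⊗ oneMinus 0 1 k) a b n ≡ 𝟙 a b n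
  coeffs a zero n = ≡.trans (⊗-oneMinus (geom 0 1 k) 0 1 k a 0 n)
    (≡.trans (≡.cong₂ ℤ._-_ (≡.trans (geom-y k 1≤k a 0 n)
                                     (≡.cong (λ e → [ ⌊ a ℕ.≟ 0 ⌋ ∧ ⌊ n ℕ.≟ e ⌋ ]) (ℕₚ.*-zeroʳ k)))
                            (q^·-zero 0 a))
             (≡.trans (ℤₚ.+-identityʳ _) (≋⇒≐ oneS≋𝟙 a 0 n)))
  coeffs a (suc b) n = ≡.trans (⊗-oneMinus (geom 0 1 k) 0 1 k a (suc b) n)
    (≡.trans (≡.cong₂ ℤ._-_ (geom-y k 1≤k a (suc b) n) previous)
    (≡.trans (ℤₚ.+-inverseʳ [ ⌊ a ℕ.≟ 0 ⌋ ∧ ⌊ n ℕ.≟ k ℕ.* suc b ⌋ ]) (≡.sym (𝟙-off a))))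
    where
    𝟙-off : ∀ a → 𝟙 a (suc b) n ≡ + 0
    𝟙-off zero = ≡.refl
    𝟙-off (suc a) = ≡.refl
    previous : (q^ 0 · (λ a′ → (q^ k · (λ n′ → geom 0 1 k a′ b n′)) n)) a ≡ [ ⌊ a ℕ.≟ 0 ⌋ ∧ ⌊ n ℕ.≟ k ℕ.* suc b ⌋ ]
    previous = ≡.trans (q^·-cong k n (λ n′ _ → geom-y k 1≤k a b n′))
      (≡.trans (q^·-indicator (λ z → [ ⌊ a ℕ.≟ 0 ⌋ ∧ z ]) (≡.cong [_] (∧-zeroʳ ⌊ a ℕ.≟ 0 ⌋)) (k ℕ.* b) k n)
               (≡.cong (λ e → [ ⌊ a ℕ.≟ 0 ⌋ ∧ ⌊ n ℕ.≟ e ⌋ ]) (≡.trans (ℕₚ.+-comm (k ℕ.* b) k) (≡.sym (ℕₚ.*-suc k b)))))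

Unitˣ Unitˣʸ : Series → Set
Unitˣ P = P 0 ℤ⟦q,y⟧.≋ ℤ⟦q,y⟧.𝟙
Unitˣʸ P = P 0 0 ℤ⟦q⟧.≋ ℤ⟦q⟧.𝟙

⊗-Unitˣ : ∀ P Q → Unitˣ P → ∀ b n → (P ⊗ Q) 0 b n ≡ Q 0 b n
⊗-Unitˣ P Q P₀≋𝟙 b n =
  ℤ⟦q⟧.coeff (ℤ⟦q,y⟧.coeff (ℤ⟦q,y⟧ʳ.trans (ℤ⟦q,y⟧ʳ.*-congʳ {Q 0} P₀≋𝟙) (ℤ⟦q,y⟧ʳ.*-identityˡ (Q 0))) b) n

⊗-Unitˣʸ : ∀ P Q → Unitˣʸ P → ∀ n → (P ⊗ Q) 0 0 n ≡ Q 0 0 n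
⊗-Unitˣʸ P Q P₀₀≋𝟙 n = ℤ⟦q⟧.coeff (ℤ⟦q⟧ʳ.trans (ℤ⟦q⟧ʳ.*-congʳ {Q 0 0} P₀₀≋𝟙) (ℤ⟦q⟧ʳ.*-identityˡ (Q 0 0))) n

infProd-Unitˣ : ∀ F → (∀ j → Unitˣ (F j)) → Unitˣ (infProd F)
infProd-Unitˣ F units = ℤ⟦q,y⟧.coeffwise λ b → ℤ⟦q⟧.coeffwise λ n →
  ≡.trans (infProd≡∏< F 0 b n) (∏<-Unitˣ F units (suc n) b n)
  where
  ∏<-Unitˣ : ∀ F → (∀ j → Unitˣ (F j)) → ∀ N b n → ∏< F N 0 b n ≡ 𝟙 0 b n
  ∏<-Unitˣ F units zero b n = ≡.refl
  ∏<-Unitˣ F units (suc N) b n =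
    ≡.trans (⊗-Unitˣ (F 0) (∏< (F ∘ suc) N) (units 0) b n) (∏<-Unitˣ (F ∘ suc) (units ∘ suc) N b n)

infProd-Unitˣʸ : ∀ F → (∀ j → Unitˣʸ (F j)) → Unitˣʸ (infProd F)
infProd-Unitˣʸ F units = ℤ⟦q⟧.coeffwise λ n → ≡.trans (infProd≡∏< F 0 0 n) (∏<-Unitˣʸ F units (suc n) n)
  where
  ∏<-Unitˣʸ : ∀ F → (∀ j → Unitˣʸ (F j)) → ∀ N n → ∏< F N 0 0 n ≡ 𝟙 0 0 n
  ∏<-Unitˣʸ F units zero n = ≡.refl
  ∏<-Unitˣʸ F units (suc N) n =
    ≡.trans (⊗-Unitˣʸ (F 0) (∏< (F ∘ suc) N) (units 0) n) (∏<-Unitˣʸ (F ∘ suc) (units ∘ suc) N n)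

-- The recurrence

record CapsidRecurrence (m r₁ r₂ : ℕ) (f : ℕ → ℕ → ℕ → ℤ) : Set where
  field
    at-0-0 : ∀ n → f 0 0 n ≡ [ ⌊ n ℕ.≟ 0 ⌋ ]
    at-0-suc : ∀ b n → f 0 (suc b) n ≡ (q^ r₂ · f 0 b) n ℤ.+ (q^ (m ℕ.* suc b) · f 0 (suc b)) n
    at-suc-0 : ∀ a n → f (suc a) 0 n ≡ (q^ r₁ · f a 0) n ℤ.+ (q^ (m ℕ.* suc a) · f (suc a) 0) n
    at-suc-suc : ∀ a b n →
      f (suc a) (suc b) n ℤ.+ (q^ (r₁ ℕ.+ r₂) · q^ (m ℕ.* a) · f a b) n
        ≡ (q^ (m ℕ.* suc a) · f (suc a) (suc b)) n ℤ.+ (q^ r₁ · f a (suc b)) n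

module _ {m r₁ r₂ : ℕ} {f g : ℕ → ℕ → ℕ → ℤ} (1≤m : 1 ≤ m) (1≤r₂ : 1 ≤ r₂)
         (f-rec : CapsidRecurrence m r₁ r₂ f) (g-rec : CapsidRecurrence m r₁ r₂ g) where

  private
    module f = CapsidRecurrence f-rec
    module g = CapsidRecurrence g-rec
    open import Algebra.Properties.Group (CommutativeRing.+-group ℤₚ.+-*-commutativeRing) using (∙-cancelʳ)

    0<m*suc : ∀ a → 0 < m ℕ.* suc a
    0<m*suc a = ℕₚ.≤-trans 1≤m (ℕₚ.m≤m*n m (suc a))

    unique-at-x⁰ : ∀ n b → f 0 b n ≡ g 0 b n
    unique-at-x⁰ = <-rec _ step
      where
      step : ∀ n → (∀ {k} → k < n → ∀ b → f 0 b k ≡ g 0 b k) → ∀ b → f 0 b n ≡ g 0 b n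
      step n ih zero = ≡.trans (f.at-0-0 n) (≡.sym (g.at-0-0 n))
      step n ih (suc b) = ≡.trans (f.at-0-suc b n) (≡.trans
        (≡.cong₂ ℤ._+_ (q^·-cong-< n 1≤r₂ (λ k k<n → ih k<n b))
                       (q^·-cong-< n (0<m*suc b) (λ k k<n → ih k<n (suc b))))
        (≡.sym (g.at-0-suc b n)))

    unique-at-suc : ∀ a → (∀ b n → f a b n ≡ g a b n) → ∀ n b → f (suc a) b n ≡ g (suc a) b n
    unique-at-suc a f≡g = <-rec _ step
      where
      step : ∀ n → (∀ {k} → k < n → ∀ b → f (suc a) b k ≡ g (suc a) b k) → ∀ b → f (suc a) b n ≡ g (suc a) b n
      step n ih zero = ≡.trans (f.at-suc-0 a n) (≡.trans
        (≡.cong₂ ℤ._+_ (q^·-cong r₁ n (λ k _ → f≡g 0 k))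
                       (q^·-cong-< n (0<m*suc a) (λ k k<n → ih k<n 0)))
        (≡.sym (g.at-suc-0 a n)))
      step n ih (suc b) = ∙-cancelʳ W (f (suc a) (suc b) n) (g (suc a) (suc b) n) (begin
        f (suc a) (suc b) n ℤ.+ W                                                 ≡⟨ f.at-suc-suc a b n ⟩
        (q^ (m ℕ.* suc a) · f (suc a) (suc b)) n ℤ.+ (q^ r₁ · f a (suc b)) n       ≡⟨ ≡.cong₂ ℤ._+_
          (q^·-cong-< n (0<m*suc a) (λ k k<n → ih k<n (suc b))) (q^·-cong r₁ n (λ k _ → f≡g (suc b) k)) ⟩
        (q^ (m ℕ.* suc a) · g (suc a) (suc b)) n ℤ.+ (q^ r₁ · g a (suc b)) n       ≡⟨ g.at-suc-suc a b n ⟨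
        g (suc a) (suc b) n ℤ.+ (q^ (r₁ ℕ.+ r₂) · q^ (m ℕ.* a) · g a b) n         ≡⟨ ≡.cong (λ t → g (suc a) (suc b) n ℤ.+ t) W-same ⟨
        g (suc a) (suc b) n ℤ.+ W                                                 ∎)
        where
        open ≡.≡-Reasoning
        W = (q^ (r₁ ℕ.+ r₂) · q^ (m ℕ.* a) · f a b) n
        W-same : W ≡ (q^ (r₁ ℕ.+ r₂) · q^ (m ℕ.* a) · g a b) n
        W-same = q^·-cong (r₁ ℕ.+ r₂) n (λ k _ → q^·-cong (m ℕ.* a) k (λ j _ → f≡g b j))

  CapsidRecurrence-unique : ∀ a b n → f a b n ≡ g a b n
  CapsidRecurrence-unique zero b n = unique-at-x⁰ n b
  CapsidRecurrence-unique (suc a) b n = unique-at-suc a (CapsidRecurrence-unique a) n b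

-- The product side

x-y≡z-w⇒x+w≡z+y : ∀ x y z w → x ℤ.- y ≡ z ℤ.- w → x ℤ.+ w ≡ z ℤ.+ y
x-y≡z-w⇒x+w≡z+y x y z w eq = begin
  x ℤ.+ w                       ≡⟨ regroup x y w ⟩
  (x ℤ.- y) ℤ.+ (y ℤ.+ w)       ≡⟨ ≡.cong (ℤ._+ (y ℤ.+ w)) eq ⟩
  (z ℤ.- w) ℤ.+ (y ℤ.+ w)       ≡⟨ cancel z w y ⟩
  z ℤ.+ y                       ∎
  where
  open ≡.≡-Reasoning
  regroup : ∀ x y w → x ℤ.+ w ≡ (x ℤ.- y) ℤ.+ (y ℤ.+ w)
  regroup = solve-∀
  cancel : ∀ z w y → (z ℤ.- w) ℤ.+ (y ℤ.+ w) ≡ z ℤ.+ y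
  cancel = solve-∀

x-y≡z⇒x≡y+z : ∀ x y z → x ℤ.- y ≡ z → x ≡ y ℤ.+ z
x-y≡z⇒x≡y+z x y z eq = ≡.trans (regroup x y) (≡.cong (λ t → y ℤ.+ t) eq)
  where
  regroup : ∀ x y → x ≡ y ℤ.+ (x ℤ.- y)
  regroup = solve-∀

module CapsidProduct (m r₁ r₂ : ℕ) (1≤m : 1 ≤ m) (1≤r₁ : 1 ≤ r₁) (1≤r₂ : 1 ≤ r₂) where

  Eᶠ Xᶠ Yᶠ : ℕ → Series
  Eᶠ j = oneMinus 1 1 (r₁ ℕ.+ r₂ ℕ.+ m ℕ.* j)
  Xᶠ j = geom 1 0 (r₁ ℕ.+ m ℕ.* j)
  Yᶠ j = geom 0 1 (r₂ ℕ.+ m ℕ.* j)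

  E X Y F : Series
  E = infProd Eᶠ
  X = infProd Xᶠ
  Y = infProd Yᶠ
  F = capsidRHS m r₁ r₂

  private
    index< : ∀ r j → 1 ≤ r → j < r ℕ.+ m ℕ.* j
    index< r j 1≤r = ℕₚ.+-mono-≤ 1≤r (ℕₚ.m≤n*m j m {{ℕ.>-nonZero 1≤m}})

    1≤r+ : ∀ r j → 1 ≤ r → 1 ≤ r ℕ.+ m ℕ.* j
    1≤r+ r j 1≤r = ℕₚ.≤-trans 1≤r (ℕₚ.m≤m+n r _)

    r+m*suc : ∀ r j → r ℕ.+ m ℕ.* suc j ≡ r ℕ.+ m ℕ.* j ℕ.+ m
    r+m*suc r j = ≡.trans (≡.cong (r ℕ.+_) (≡.trans (ℕₚ.*-suc m j) (ℕₚ.+-comm m _))) (≡.sym (ℕₚ.+-assoc r _ m))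

  Eᶠ-convergent : ConvergentFactors Eᶠ
  Eᶠ-convergent j = agreeUpTo λ a b k k≤j →
    ≡.trans (≡.cong (λ t → oneS a b k ℤ.- [ ⌊ a ℕ.≟ 1 ⌋ ∧ (⌊ b ℕ.≟ 1 ⌋ ∧ t) ])
                    (⌊≟⌋-false (λ { ≡.refl → ℕₚ.<-irrefl ≡.refl (ℕₚ.≤-<-trans k≤j (index< (r₁ ℕ.+ r₂) j 1≤r₁+r₂)) })))
    (≡.trans (≡.cong (λ t → oneS a b k ℤ.- [ t ]) (≡.trans (≡.cong (⌊ a ℕ.≟ 1 ⌋ ∧_) (∧-zeroʳ _)) (∧-zeroʳ _)))
    (≡.trans (ℤₚ.+-identityʳ _) (≋⇒≐ oneS≋𝟙 a b k)))
    where
    1≤r₁+r₂ = ℕₚ.≤-trans 1≤r₁ (ℕₚ.m≤m+n r₁ r₂)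

  Xᶠ-convergent : ConvergentFactors Xᶠ
  Xᶠ-convergent j = agreeUpTo coeffs
    where
    c = r₁ ℕ.+ m ℕ.* j
    coeffs : ∀ a b k → k ≤ j → Xᶠ j a b k ≡ 𝟙 a b k
    coeffs zero b k _ = ≡.trans (geom-x c (1≤r+ r₁ j 1≤r₁) 0 b k)
      (≡.trans (≡.cong (λ e → [ ⌊ b ℕ.≟ 0 ⌋ ∧ ⌊ k ℕ.≟ e ⌋ ]) (ℕₚ.*-zeroʳ c)) (≋⇒≐ oneS≋𝟙 0 b k))
    coeffs (suc a) b k k≤j = ≡.trans (geom-x c (1≤r+ r₁ j 1≤r₁) (suc a) b k)
      (≡.trans (≡.cong (λ t → [ ⌊ b ℕ.≟ 0 ⌋ ∧ t ]) (⌊≟⌋-false {k} {c ℕ.* suc a} (λ { ≡.refl → ℕₚ.<-irrefl ≡.refl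
          (ℕₚ.≤-<-trans k≤j (ℕₚ.<-≤-trans (index< r₁ j 1≤r₁) (ℕₚ.m≤m*n c (suc a)))) })))
      (≡.cong [_] (∧-zeroʳ ⌊ b ℕ.≟ 0 ⌋)))

  Yᶠ-convergent : ConvergentFactors Yᶠ
  Yᶠ-convergent j = agreeUpTo coeffs
    where
    c = r₂ ℕ.+ m ℕ.* j
    coeffs : ∀ a b k → k ≤ j → Yᶠ j a b k ≡ 𝟙 a b k
    coeffs a zero k _ = ≡.trans (geom-y c (1≤r+ r₂ j 1≤r₂) a 0 k)
      (≡.trans (≡.cong (λ e → [ ⌊ a ℕ.≟ 0 ⌋ ∧ ⌊ k ℕ.≟ e ⌋ ]) (ℕₚ.*-zeroʳ c)) (≋⇒≐ oneS≋𝟙 a 0 k))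
    coeffs a (suc b) k k≤j = ≡.trans (geom-y c (1≤r+ r₂ j 1≤r₂) a (suc b) k)
      (≡.trans (≡.cong (λ t → [ ⌊ a ℕ.≟ 0 ⌋ ∧ t ]) (⌊≟⌋-false {k} {c ℕ.* suc b} (λ { ≡.refl → ℕₚ.<-irrefl ≡.refl
          (ℕₚ.≤-<-trans k≤j (ℕₚ.<-≤-trans (index< r₂ j 1≤r₂) (ℕₚ.m≤m*n c (suc b)))) })))
      (≡.trans (≡.cong [_] (∧-zeroʳ ⌊ a ℕ.≟ 0 ⌋)) (𝟙-off a)))
      where
      𝟙-off : ∀ a → + 0 ≡ 𝟙 a (suc b) k
      𝟙-off zero = ≡.refl
      𝟙-off (suc a) = ≡.refl

  private
    module SX = ScaleX m
    module SY = ScaleY m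

  scaleX-Eᶠ : ∀ j → scaleX m (Eᶠ j) ≋ Eᶠ (suc j)
  scaleX-Eᶠ j = ≐⇒≋ coeffs
    where
    coeffs : ∀ a b n → scaleX m (Eᶠ j) a b n ≡ Eᶠ (suc j) a b n
    coeffs zero b n = ≡.trans (≡.cong (λ s → (q^ s · Eᶠ j 0 b) n) (ℕₚ.*-zeroʳ m)) (q^·-≤ {0} {n} (Eᶠ j 0 b) z≤n)
    coeffs (suc zero) b n = ≡.trans (≡.cong (λ s → (q^ s · Eᶠ j 1 b) n) (ℕₚ.*-identityʳ m))
      (≡.trans (q^·-indicator (λ t → + 0 ℤ.- [ ⌊ b ℕ.≟ 1 ⌋ ∧ t ]) (≡.cong (λ t → + 0 ℤ.- [ t ]) (∧-zeroʳ ⌊ b ℕ.≟ 1 ⌋))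
                              (r₁ ℕ.+ r₂ ℕ.+ m ℕ.* j) m n)
               (≡.cong (λ e → + 0 ℤ.- [ ⌊ b ℕ.≟ 1 ⌋ ∧ ⌊ n ℕ.≟ e ⌋ ]) (≡.sym (r+m*suc (r₁ ℕ.+ r₂) j))))
    coeffs (suc (suc a)) b n = q^·-zero (m ℕ.* suc (suc a)) n

  scaleX-Xᶠ : ∀ j → scaleX m (Xᶠ j) ≋ Xᶠ (suc j)
  scaleX-Xᶠ j = ≐⇒≋ λ a b n →
    ≡.trans (q^·-cong (m ℕ.* a) n (λ n′ _ → geom-x _ (1≤r+ r₁ j 1≤r₁) a b n′))
    (≡.trans (q^·-indicator (λ t → [ ⌊ b ℕ.≟ 0 ⌋ ∧ t ]) (≡.cong [_] (∧-zeroʳ ⌊ b ℕ.≟ 0 ⌋)) ((r₁ ℕ.+ m ℕ.* j) ℕ.* a) (m ℕ.* a) n)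
    (≡.trans (≡.cong (λ e → [ ⌊ b ℕ.≟ 0 ⌋ ∧ ⌊ n ℕ.≟ e ⌋ ])
                     (≡.trans (≡.sym (ℕₚ.*-distribʳ-+ a (r₁ ℕ.+ m ℕ.* j) m)) (≡.cong (ℕ._* a) (≡.sym (r+m*suc r₁ j)))))
             (≡.sym (geom-x _ (1≤r+ r₁ (suc j) 1≤r₁) a b n))))

  scaleX-Yᶠ : ∀ j → scaleX m (Yᶠ j) ≋ Yᶠ j
  scaleX-Yᶠ j = ≐⇒≋ coeffs
    where
    coeffs : ∀ a b n → scaleX m (Yᶠ j) a b n ≡ Yᶠ j a b n
    coeffs zero b n = ≡.trans (≡.cong (λ s → (q^ s · Yᶠ j 0 b) n) (ℕₚ.*-zeroʳ m)) (q^·-≤ {0} {n} (Yᶠ j 0 b) z≤n)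
    coeffs (suc a) b n =
      ≡.trans (q^·-cong (m ℕ.* suc a) n (λ n′ _ → geom-y _ (1≤r+ r₂ j 1≤r₂) (suc a) b n′))
              (≡.trans (q^·-zero (m ℕ.* suc a) n) (≡.sym (geom-y _ (1≤r+ r₂ j 1≤r₂) (suc a) b n)))

  scaleY-Yᶠ : ∀ j → scaleY m (Yᶠ j) ≋ Yᶠ (suc j)
  scaleY-Yᶠ j = ≐⇒≋ λ a b n →
    ≡.trans (q^·-cong (m ℕ.* b) n (λ n′ _ → geom-y _ (1≤r+ r₂ j 1≤r₂) a b n′))
    (≡.trans (q^·-indicator (λ t → [ ⌊ a ℕ.≟ 0 ⌋ ∧ t ]) (≡.cong [_] (∧-zeroʳ ⌊ a ℕ.≟ 0 ⌋)) ((r₂ ℕ.+ m ℕ.* j) ℕ.* b) (m ℕ.* b) n)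
    (≡.trans (≡.cong (λ e → [ ⌊ a ℕ.≟ 0 ⌋ ∧ ⌊ n ℕ.≟ e ⌋ ])
                     (≡.trans (≡.sym (ℕₚ.*-distribʳ-+ b (r₂ ℕ.+ m ℕ.* j) m)) (≡.cong (ℕ._* b) (≡.sym (r+m*suc r₂ j)))))
             (≡.sym (geom-y _ (1≤r+ r₂ (suc j) 1≤r₂) a b n))))

  private
    unfold : ∀ G (σ : Series → Series) → ConvergentFactors G →
      σ (infProd G) ≋ infProd (σ ∘ G) → (∀ j → σ (G j) ≋ G (suc j)) → infProd G ≋ G 0 ⊗ σ (infProd G)
    unfold G σ conv σ-infProd σ-G = 𝕊.trans (infProd-unfold G conv)
      (𝕊.*-congˡ {G 0} (𝕊.sym (𝕊.trans σ-infProd (infProd-cong σ-G))))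

    r+m*0 : ∀ r → r ℕ.+ m ℕ.* 0 ≡ r
    r+m*0 r = ≡.trans (≡.cong (r ℕ.+_) (ℕₚ.*-zeroʳ m)) (ℕₚ.+-identityʳ r)

  E-unfold : E ≋ oneMinus 1 1 (r₁ ℕ.+ r₂) ⊗ scaleX m E
  E-unfold = ≡.subst (λ c → E ≋ oneMinus 1 1 c ⊗ scaleX m E) (r+m*0 (r₁ ℕ.+ r₂))
    (unfold Eᶠ (scaleX m) Eᶠ-convergent (SX.scaleX-infProd Eᶠ Eᶠ-convergent) scaleX-Eᶠ)

  X-unfold : X ≋ geom 1 0 r₁ ⊗ scaleX m X
  X-unfold = ≡.subst (λ c → X ≋ geom 1 0 c ⊗ scaleX m X) (r+m*0 r₁)
    (unfold Xᶠ (scaleX m) Xᶠ-convergent (SX.scaleX-infProd Xᶠ Xᶠ-convergent) scaleX-Xᶠ)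

  Y-unfold : Y ≋ geom 0 1 r₂ ⊗ scaleY m Y
  Y-unfold = ≡.subst (λ c → Y ≋ geom 0 1 c ⊗ scaleY m Y) (r+m*0 r₂)
    (unfold Yᶠ (scaleY m) Yᶠ-convergent (SY.scaleY-infProd Yᶠ Yᶠ-convergent) scaleY-Yᶠ)

  scaleX-Y : scaleX m Y ≋ Y
  scaleX-Y = 𝕊.trans (SX.scaleX-infProd Yᶠ Yᶠ-convergent) (infProd-cong scaleX-Yᶠ)

  F≋EXY : F ≋ (E ⊗ X) ⊗ Y
  F≋EXY = 𝕊.trans (⊛≋⊗ (E ⊛ X) Y) (𝕊.*-congʳ {Y} (⊛≋⊗ E X))

  X-equation : X ⊗ oneMinus 1 0 r₁ ≋ scaleX m X
  X-equation = begin
    X ⊗ o                        ≈⟨ 𝕊.*-congʳ {o} X-unfold ⟩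
    (g ⊗ scaleX m X) ⊗ o         ≈⟨ xy∙z≈y∙xz g (scaleX m X) o ⟩
    scaleX m X ⊗ (g ⊗ o)         ≈⟨ 𝕊.*-congˡ {scaleX m X} (geom-x⊗oneMinus r₁ 1≤r₁) ⟩
    scaleX m X ⊗ 𝟙               ≈⟨ 𝕊.*-identityʳ (scaleX m X) ⟩
    scaleX m X                   ∎
    where
    open ≋-Reasoning
    o = oneMinus 1 0 r₁
    g = geom 1 0 r₁

  Y-equation : Y ⊗ oneMinus 0 1 r₂ ≋ scaleY m Y
  Y-equation = begin
    Y ⊗ o                        ≈⟨ 𝕊.*-congʳ {o} Y-unfold ⟩
    (g ⊗ scaleY m Y) ⊗ o         ≈⟨ xy∙z≈y∙xz g (scaleY m Y) o ⟩
    scaleY m Y ⊗ (g ⊗ o)         ≈⟨ 𝕊.*-congˡ {scaleY m Y} (geom-y⊗oneMinus r₂ 1≤r₂) ⟩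
    scaleY m Y ⊗ 𝟙               ≈⟨ 𝕊.*-identityʳ (scaleY m Y) ⟩
    scaleY m Y                   ∎
    where
    open ≋-Reasoning
    o = oneMinus 0 1 r₂
    g = geom 0 1 r₂

  F-equation : F ⊗ oneMinus 1 0 r₁ ≋ scaleX m F ⊗ oneMinus 1 1 (r₁ ℕ.+ r₂)
  F-equation = begin
    F ⊗ o₁                                        ≈⟨ 𝕊.*-congʳ {o₁} F≋EXY ⟩
    ((E ⊗ X) ⊗ Y) ⊗ o₁                            ≈⟨ rearrange₁ ⟩
    (E ⊗ Y) ⊗ (X ⊗ o₁)                            ≈⟨ 𝕊.*-cong (𝕊.*-congʳ {Y} E-unfold) X-equation ⟩
    ((o₂ ⊗ scaleX m E) ⊗ Y) ⊗ scaleX m X          ≈⟨ rearrange₂ ⟩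
    ((scaleX m E ⊗ scaleX m X) ⊗ Y) ⊗ o₂          ≈⟨ 𝕊.*-congʳ {o₂} scaleX-EXY ⟨
    scaleX m F ⊗ o₂                               ∎
    where
    open ≋-Reasoning
    open import Algebra.Solver.CommutativeMonoid 𝕊.*-commutativeMonoid using (prove; var) renaming (_⊕_ to _∙_)
    o₁ = oneMinus 1 0 r₁
    o₂ = oneMinus 1 1 (r₁ ℕ.+ r₂)
    rearrange₁ : ((E ⊗ X) ⊗ Y) ⊗ o₁ ≋ (E ⊗ Y) ⊗ (X ⊗ o₁)
    rearrange₁ = prove 4 (((e ∙ x) ∙ y) ∙ o) ((e ∙ y) ∙ (x ∙ o)) (E ∷ X ∷ Y ∷ o₁ ∷ [])
      where e = var (# 0) ; x = var (# 1) ; y = var (# 2) ; o = var (# 3)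
    rearrange₂ : ((o₂ ⊗ scaleX m E) ⊗ Y) ⊗ scaleX m X ≋ ((scaleX m E ⊗ scaleX m X) ⊗ Y) ⊗ o₂
    rearrange₂ = prove 4 (((o ∙ e) ∙ y) ∙ x) (((e ∙ x) ∙ y) ∙ o) (scaleX m E ∷ scaleX m X ∷ Y ∷ o₂ ∷ [])
      where e = var (# 0) ; x = var (# 1) ; y = var (# 2) ; o = var (# 3)
    scaleX-EXY : scaleX m F ≋ (scaleX m E ⊗ scaleX m X) ⊗ Y
    scaleX-EXY = 𝕊.trans (scaleX-cong F≋EXY) (𝕊.trans (SX.scaleX-⊗ (E ⊗ X) Y)
      (𝕊.*-cong (SX.scaleX-⊗ E X) scaleX-Y))
      where scaleX-cong = scaleBy-cong (λ a _ → m ℕ.* a)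

  E-Unitˣ : Unitˣ E
  E-Unitˣ = infProd-Unitˣ Eᶠ λ j → ℤ⟦q,y⟧.coeffwise λ b → ℤ⟦q⟧.coeffwise λ n →
    ≡.trans (ℤₚ.+-identityʳ _) (≋⇒≐ oneS≋𝟙 0 b n)

  X-Unitˣ : Unitˣ X
  X-Unitˣ = infProd-Unitˣ Xᶠ λ j → ℤ⟦q,y⟧.coeffwise λ b → ℤ⟦q⟧.coeffwise λ n →
    ≡.trans (geom-x _ (1≤r+ r₁ j 1≤r₁) 0 b n)
            (≡.trans (≡.cong (λ e → [ ⌊ b ℕ.≟ 0 ⌋ ∧ ⌊ n ℕ.≟ e ⌋ ]) (ℕₚ.*-zeroʳ (r₁ ℕ.+ m ℕ.* j))) (≋⇒≐ oneS≋𝟙 0 b n))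

  Y-Unitˣʸ : Unitˣʸ Y
  Y-Unitˣʸ = infProd-Unitˣʸ Yᶠ λ j → ℤ⟦q⟧.coeffwise λ n →
    ≡.trans (geom-y _ (1≤r+ r₂ j 1≤r₂) 0 0 n)
            (≡.trans (≡.cong (λ e → [ ⌊ n ℕ.≟ e ⌋ ]) (ℕₚ.*-zeroʳ (r₂ ℕ.+ m ℕ.* j))) (indicator n))
    where
    indicator : ∀ n → [ ⌊ n ℕ.≟ 0 ⌋ ] ≡ 𝟙 0 0 n
    indicator zero = ≡.refl
    indicator (suc n) = ≡.refl

  F-at-x⁰ : ∀ b n → F 0 b n ≡ Y 0 b n
  F-at-x⁰ b n = ≡.trans (≋⇒≐ F≋EXY 0 b n) (⊗-Unitˣ (E ⊗ X) Y EX-Unitˣ b n)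
    where
    EX-Unitˣ : Unitˣ (E ⊗ X)
    EX-Unitˣ = ℤ⟦q,y⟧.coeffwise λ b → ℤ⟦q⟧.coeffwise λ n →
      ≡.trans (⊗-Unitˣ E X E-Unitˣ b n) (ℤ⟦q⟧.coeff (ℤ⟦q,y⟧.coeff X-Unitˣ b) n)

  F-recurrence : CapsidRecurrence m r₁ r₂ F
  F-recurrence = record
    { at-0-0 = λ n → ≡.trans (F-at-x⁰ 0 n) (≡.trans (ℤ⟦q⟧.coeff Y-Unitˣʸ n) (indicator n))
    ; at-0-suc = λ b n → ≡.trans (F-at-x⁰ (suc b) n) (≡.trans (Y-step b n)
        (≡.cong₂ ℤ._+_ (q^·-cong r₂ n (λ k _ → ≡.sym (F-at-x⁰ b k)))
                       (q^·-cong (m ℕ.* suc b) n (λ k _ → ≡.sym (F-at-x⁰ (suc b) k)))))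
    ; at-suc-0 = λ a n → x-y≡z⇒x≡y+z (F (suc a) 0 n) ((q^ r₁ · F a 0) n) ((q^ (m ℕ.* suc a) · F (suc a) 0) n)
        (≡.trans (F-coeff a 0 n) (ℤₚ.+-identityʳ _))
    ; at-suc-suc = λ a b n → x-y≡z-w⇒x+w≡z+y (F (suc a) (suc b) n) ((q^ r₁ · F a (suc b)) n)
        ((q^ (m ℕ.* suc a) · F (suc a) (suc b)) n) ((q^ (r₁ ℕ.+ r₂) · q^ (m ℕ.* a) · F a b) n) (F-coeff a (suc b) n)
    }
    where
    indicator : ∀ n → 𝟙 0 0 n ≡ [ ⌊ n ℕ.≟ 0 ⌋ ]
    indicator zero = ≡.refl
    indicator (suc n) = ≡.refl
    F-coeff : ∀ a b n → F (suc a) b n ℤ.- (q^ r₁ · F a b) n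
      ≡ (q^ (m ℕ.* suc a) · F (suc a) b) n ℤ.- (q^ 1 · (λ b′ → (q^ (r₁ ℕ.+ r₂) · scaleX m F a b′) n)) b
    F-coeff a b n = ≡.trans (≡.sym (⊗-oneMinus F 1 0 r₁ (suc a) b n))
      (≡.trans (≋⇒≐ F-equation (suc a) b n) (⊗-oneMinus (scaleX m F) 1 1 (r₁ ℕ.+ r₂) (suc a) b n))
    Y-step : ∀ b n → Y 0 (suc b) n ≡ (q^ r₂ · Y 0 b) n ℤ.+ (q^ (m ℕ.* suc b) · Y 0 (suc b)) n
    Y-step b n = x-y≡z⇒x≡y+z (Y 0 (suc b) n) ((q^ r₂ · Y 0 b) n) ((q^ (m ℕ.* suc b) · Y 0 (suc b)) n)
      (≡.trans (≡.sym (⊗-oneMinus Y 0 1 r₂ 0 (suc b) n)) (≋⇒≐ Y-equation 0 (suc b) n))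

-- Finite types

Finite : Set → Set
Finite A = Σ ℕ (λ k → Fin k ↔ A)

card : ∀ {A} → Finite A → ℕ
card = proj₁

card-unique : ∀ {A} (p q : Finite A) → card p ≡ card q
card-unique (k , e) (l , f) = ↔⇒≡ (↔-trans e (↔-sym f))

Finite-↔ : ∀ {A B} → Finite A → A ↔ B → Finite B
Finite-↔ (k , e) f = k , ↔-trans e f

Finite-⊥ : ∀ {A} → ¬ A → Finite A
Finite-⊥ ¬a = 0 , mk↔ₛ′ (λ ()) (⊥-elim ∘ ¬a) (⊥-elim ∘ ¬a) (λ ())

Finite-singleton : ∀ {A} → A → (∀ x y → x ≡ y) → Finite A
Finite-singleton a all-equal = 1 , mk↔ₛ′ (λ _ → a) (λ _ → Fin.zero) (all-equal a) (λ { Fin.zero → ≡.refl ; (Fin.suc ()) })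

Finite-⊎ : ∀ {A B} → Finite A → Finite B → Finite (A ⊎ B)
Finite-⊎ (k , e) (l , f) = k ℕ.+ l , ↔-trans (+↔⊎ {k} {l}) (e ⊎-↔ f)

Finite-Σ-Fin : ∀ k (P : Fin k → Set) → Decidable P → (∀ i → Irrelevant (P i)) → Finite (Σ (Fin k) P)
Finite-Σ-Fin zero P P? P-irr = Finite-⊥ (λ { (() , _) })
Finite-Σ-Fin (suc k) P P? P-irr =
  Finite-↔ (Finite-⊎ at-zero (Finite-Σ-Fin k (P ∘ Fin.suc) (P? ∘ Fin.suc) (P-irr ∘ Fin.suc))) split
  where
  at-zero : Finite (P Fin.zero)
  at-zero with P? Fin.zero
  ... | yes p = Finite-singleton p (P-irr Fin.zero)
  ... | no ¬p = Finite-⊥ ¬p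
  split : (P Fin.zero ⊎ Σ (Fin k) (P ∘ Fin.suc)) ↔ Σ (Fin (suc k)) P
  split = mk↔ₛ′ (λ { (inj₁ p) → Fin.zero , p ; (inj₂ (i , p)) → Fin.suc i , p })
                (λ { (Fin.zero , p) → inj₁ p ; (Fin.suc i , p) → inj₂ (i , p) })
                (λ { (Fin.zero , p) → ≡.refl ; (Fin.suc i , p) → ≡.refl })
                (λ { (inj₁ p) → ≡.refl ; (inj₂ (i , p)) → ≡.refl })

Finite-Σ : ∀ {A} → Finite A → (P : A → Set) → Decidable P → (∀ x → Irrelevant (P x)) → Finite (Σ A P)
Finite-Σ {A} (k , e) P P? P-irr = Finite-↔ (Finite-Σ-Fin k (P ∘ to) (P? ∘ to) (P-irr ∘ to)) reindex
  where
  open Inverse e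
  reindex : Σ (Fin k) (P ∘ to) ↔ Σ A P
  reindex = mk↔ₛ′ (λ (i , p) → to i , p) (λ (x , p) → from x , ≡.subst P (≡.sym (strictlyInverseˡ x)) p)
    (λ (x , p) → Σ-≡ (strictlyInverseˡ x) p)
    (λ (i , p) → Σ-≡′ (strictlyInverseʳ i) (strictlyInverseˡ (to i)) p)
    where
    Σ-≡ : ∀ {x y} (y≡x : y ≡ x) (p : P x) → (y , ≡.subst P (≡.sym y≡x) p) ≡ (x , p)
    Σ-≡ ≡.refl p = ≡.refl
    Σ-≡′ : ∀ {i j} → j ≡ i → (e : to j ≡ to i) (p : P (to i)) → (j , ≡.subst P (≡.sym e) p) ≡ (i , p)
    Σ-≡′ {i} ≡.refl e p = ≡.cong (i ,_) (P-irr (to i) _ p)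

split-by-zero↔ : ∀ {A : Set} (g : A → ℕ) → A ↔ (Σ A (λ x → 0 < g x) ⊎ Σ A (λ x → g x ≡ 0))
split-by-zero↔ {A} g = mk↔ₛ′ to from to∘from from∘to
  where
  classify : (x : A) (k : ℕ) → g x ≡ k → Σ A (λ x → 0 < g x) ⊎ Σ A (λ x → g x ≡ 0)
  classify x zero gx≡0 = inj₂ (x , gx≡0)
  classify x (suc k) gx≡1+k = inj₁ (x , ≡.subst (0 <_) (≡.sym gx≡1+k) (s≤s z≤n))
  to : A → Σ A (λ x → 0 < g x) ⊎ Σ A (λ x → g x ≡ 0)
  to x = classify x (g x) ≡.refl
  from : Σ A (λ x → 0 < g x) ⊎ Σ A (λ x → g x ≡ 0) → A
  from (inj₁ (x , _)) = x
  from (inj₂ (x , _)) = x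
  from∘classify : ∀ x k (e : g x ≡ k) → from (classify x k e) ≡ x
  from∘classify x zero e = ≡.refl
  from∘classify x (suc k) e = ≡.refl
  from∘to : ∀ x → from (to x) ≡ x
  from∘to x = from∘classify x (g x) ≡.refl
  classify-pos : ∀ x (p : 0 < g x) k (e : g x ≡ k) → classify x k e ≡ inj₁ (x , p)
  classify-pos x p zero e = ⊥-elim (ℕₚ.<-irrefl (≡.sym e) p)
  classify-pos x p (suc k) e = ≡.cong (λ q → inj₁ (x , q)) (ℕₚ.<-irrelevant _ p)
  classify-zero : ∀ x (p : g x ≡ 0) k (e : g x ≡ k) → classify x k e ≡ inj₂ (x , p)
  classify-zero x p zero e = ≡.cong (λ q → inj₂ (x , q)) (ℕₚ.≡-irrelevant _ p)
  classify-zero x p (suc k) e with () ← ≡.trans (≡.sym e) p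
  to∘from : ∀ y → to (from y) ≡ y
  to∘from (inj₁ (x , p)) = classify-pos x p (g x) ≡.refl
  to∘from (inj₂ (x , p)) = classify-zero x p (g x) ≡.refl

-- Shifted v T n is the combinatorial counterpart of (q^ v · |T|) n.
Shifted : ℕ → (ℕ → Set) → ℕ → Set
Shifted v T n = Σ (v ≤ n) (λ _ → T (n ∸ v))

Finite-Shifted-≤ : ∀ {v n} {T : ℕ → Set} → v ≤ n → Finite (T (n ∸ v)) → Finite (Shifted v T n)
Finite-Shifted-≤ v≤n fin = Finite-↔ fin
  (mk↔ₛ′ (v≤n ,_) proj₂ (λ (v≤n′ , t) → ≡.cong (_, t) (ℕₚ.≤-irrelevant v≤n v≤n′)) (λ _ → ≡.refl))

Finite-Shifted : ∀ v n (T : ℕ → Set) → (v ≤ n → Finite (T (n ∸ v))) → Finite (Shifted v T n)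
Finite-Shifted v n T fin with v ℕ.≤? n
... | yes v≤n = Finite-Shifted-≤ {T = T} v≤n (fin v≤n)
... | no v≰n = Finite-⊥ (v≰n ∘ proj₁)

card-Shifted : ∀ v n {T : ℕ → Set} (fin : ∀ k → Finite (T k)) (p : Finite (Shifted v T n)) →
  + card p ≡ (q^ v · (λ k → + card (fin k))) n
card-Shifted v n {T} fin p = by-cases (v ℕ.≤? n)
  where
  by-cases : Dec (v ≤ n) → + card p ≡ (q^ v · (λ k → + card (fin k))) n
  by-cases (yes v≤n) = ≡.trans (≡.cong +_ (card-unique p (Finite-Shifted-≤ {T = T} v≤n (fin (n ∸ v)))))
                               (≡.sym (q^·-≤ (λ k → + card (fin k)) v≤n))
  by-cases (no v≰n) = ≡.trans (≡.cong +_ (card-unique p (Finite-⊥ (v≰n ∘ proj₁))))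
                              (≡.sym (q^·-> (λ k → + card (fin k)) v≰n))

-- Sorted lists

Sorted : List ℕ → Set
Sorted = Linked (λ a b → b ≤ a)

count : ℕ → List ℕ → ℕ
count v = countB (λ p → ⌊ p ℕ.≟ v ⌋)

insert : ℕ → List ℕ → List ℕ
insert v [] = v ∷ []
insert v (p ∷ ps) with p ℕ.≤? v
... | yes _ = v ∷ p ∷ ps
... | no _ = p ∷ insert v ps

delete : ℕ → List ℕ → List ℕ
delete v [] = []
delete v (p ∷ ps) with p ℕ.≟ v
... | yes _ = ps
... | no _ = p ∷ delete v ps

private
  Sorted-tail : ∀ {p ps} → Sorted (p ∷ ps) → Sorted ps
  Sorted-tail [-] = []
  Sorted-tail (_ ∷ s) = s

  Sorted-drop₂ : ∀ {x p ps} → Sorted (x ∷ p ∷ ps) → Sorted (x ∷ ps)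
  Sorted-drop₂ {ps = []} _ = [-]
  Sorted-drop₂ {ps = q ∷ qs} (p≤x ∷ (q≤p ∷ s)) = ℕₚ.≤-trans q≤p p≤x ∷ s

  insert-Sorted-∷ : ∀ x v ps → v ≤ x → Sorted (x ∷ ps) → Sorted (x ∷ insert v ps)
  insert-Sorted-∷ x v [] v≤x _ = v≤x ∷ [-]
  insert-Sorted-∷ x v (p ∷ ps) v≤x (p≤x ∷ s) with p ℕ.≤? v
  ... | yes p≤v = v≤x ∷ (p≤v ∷ s)
  ... | no p≰v = p≤x ∷ insert-Sorted-∷ p v ps (ℕₚ.<⇒≤ (ℕₚ.≰⇒> p≰v)) s

  delete-Sorted-∷ : ∀ x v ps → Sorted (x ∷ ps) → Sorted (x ∷ delete v ps)
  delete-Sorted-∷ x v [] s = [-]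
  delete-Sorted-∷ x v (p ∷ ps) s with p ℕ.≟ v
  ... | yes _ = Sorted-drop₂ s
  delete-Sorted-∷ x v (p ∷ ps) (p≤x ∷ s) | no _ = p≤x ∷ delete-Sorted-∷ p v ps s

  count>0⇒≤head : ∀ v p ps → Sorted (p ∷ ps) → 0 < count v ps → v ≤ p
  count>0⇒≤head v p (q ∷ qs) (q≤p ∷ s) c with q ℕ.≟ v
  ... | yes ≡.refl = q≤p
  ... | no _ = ℕₚ.≤-trans (count>0⇒≤head v q qs s c) q≤p

  insert-head : ∀ v ps → Sorted (v ∷ ps) → insert v ps ≡ v ∷ ps
  insert-head v [] s = ≡.refl
  insert-head v (q ∷ qs) (q≤v ∷ s) with q ℕ.≤? v
  ... | yes _ = ≡.refl
  ... | no q≰v = ⊥-elim (q≰v q≤v)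

insert-Sorted : ∀ v ps → Sorted ps → Sorted (insert v ps)
insert-Sorted v [] _ = [-]
insert-Sorted v (p ∷ ps) s with p ℕ.≤? v
... | yes p≤v = p≤v ∷ s
... | no p≰v = insert-Sorted-∷ p v ps (ℕₚ.<⇒≤ (ℕₚ.≰⇒> p≰v)) s

delete-Sorted : ∀ v ps → Sorted ps → Sorted (delete v ps)
delete-Sorted v [] s = []
delete-Sorted v (p ∷ ps) s with p ℕ.≟ v
... | yes _ = Sorted-tail s
... | no _ = delete-Sorted-∷ p v ps s

delete-insert : ∀ v ps → delete v (insert v ps) ≡ ps
delete-insert v [] with v ℕ.≟ v
... | yes _ = ≡.refl
... | no v≢v = ⊥-elim (v≢v ≡.refl)
delete-insert v (p ∷ ps) with p ℕ.≤? v
... | yes _ with v ℕ.≟ v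
...   | yes _ = ≡.refl
...   | no v≢v = ⊥-elim (v≢v ≡.refl)
delete-insert v (p ∷ ps) | no p≰v with p ℕ.≟ v
...   | yes p≡v = ⊥-elim (p≰v (ℕₚ.≤-reflexive p≡v))
...   | no _ = ≡.cong (p ∷_) (delete-insert v ps)

insert-delete : ∀ v ps → Sorted ps → 0 < count v ps → insert v (delete v ps) ≡ ps
insert-delete v (p ∷ ps) s c with p ℕ.≟ v
... | yes ≡.refl = insert-head p ps s
... | no p≢v with p ℕ.≤? v
...   | yes p≤v = ⊥-elim (p≢v (ℕₚ.≤-antisym p≤v (count>0⇒≤head v p ps s c)))
...   | no _ = ≡.cong (p ∷_) (insert-delete v ps (Sorted-tail s) c)

All-insert⁺ : ∀ {P : ℕ → Set} v ps → P v → All P ps → All P (insert v ps)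
All-insert⁺ v [] pv _ = pv ∷ []
All-insert⁺ v (p ∷ ps) pv (pp ∷ aps) with p ℕ.≤? v
... | yes _ = pv ∷ pp ∷ aps
... | no _ = pp ∷ All-insert⁺ v ps pv aps

All-insert⁻ : ∀ {P : ℕ → Set} v ps → All P (insert v ps) → All P ps
All-insert⁻ v [] _ = []
All-insert⁻ v (p ∷ ps) a with p ℕ.≤? v
All-insert⁻ v (p ∷ ps) (_ ∷ a) | yes _ = a
All-insert⁻ v (p ∷ ps) (pp ∷ a) | no _ = pp ∷ All-insert⁻ v ps a

sum-insert : ∀ v ps → sum (insert v ps) ≡ v ℕ.+ sum ps
sum-insert v [] = ≡.refl
sum-insert v (p ∷ ps) with p ℕ.≤? v
... | yes _ = ≡.refl
... | no _ = ≡.trans (≡.cong (p ℕ.+_) (sum-insert v ps)) (x+[y+z]≡y+[x+z] p v (sum ps))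

⟦_⟧ᵇ : Bool → ℕ
⟦ b ⟧ᵇ = if b then 1 else 0

countB-insert : ∀ t v ps → countB t (insert v ps) ≡ ⟦ t v ⟧ᵇ ℕ.+ countB t ps
countB-insert t v [] = ≡.refl
countB-insert t v (p ∷ ps) with p ℕ.≤? v
... | yes _ = ≡.refl
... | no _ = ≡.trans (≡.cong (⟦ t p ⟧ᵇ ℕ.+_) (countB-insert t v ps)) (x+[y+z]≡y+[x+z] ⟦ t p ⟧ᵇ ⟦ t v ⟧ᵇ _)

count-insert-self : ∀ v ps → 0 < count v (insert v ps)
count-insert-self v ps rewrite countB-insert (λ p → ⌊ p ℕ.≟ v ⌋) v ps | ⌊≟⌋-true {v} {v} ≡.refl = s≤s z≤n

count-insert-other : ∀ w v ps → v ≢ w → count w (insert v ps) ≡ count w ps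
count-insert-other w v ps v≢w = ≡.trans (countB-insert (λ p → ⌊ p ℕ.≟ w ⌋) v ps)
  (≡.cong (λ z → ⟦ z ⟧ᵇ ℕ.+ count w ps) (⌊≟⌋-false v≢w))

count>0⇒≤sum : ∀ v ps → 0 < count v ps → v ≤ sum ps
count>0⇒≤sum v (p ∷ ps) c with p ℕ.≟ v
... | yes ≡.refl = ℕₚ.m≤m+n p _
... | no _ = ℕₚ.≤-trans (count>0⇒≤sum v ps c) (ℕₚ.m≤n+m _ p)

count≡0⇒All≢ : ∀ v ps → count v ps ≡ 0 → All (_≢ v) ps
count≡0⇒All≢ v [] _ = []
count≡0⇒All≢ v (p ∷ ps) c with p ℕ.≟ v
... | no p≢v = p≢v ∷ count≡0⇒All≢ v ps c

All≢⇒count≡0 : ∀ v ps → All (_≢ v) ps → count v ps ≡ 0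
All≢⇒count≡0 v [] _ = ≡.refl
All≢⇒count≡0 v (p ∷ ps) (p≢v ∷ a) with p ℕ.≟ v
... | yes p≡v = ⊥-elim (p≢v p≡v)
... | no _ = All≢⇒count≡0 v ps a

countB>0 : ∀ t v ps → 0 < count v ps → t v ≡ true → 0 < countB t ps
countB>0 t v (p ∷ ps) c tv with p ℕ.≟ v
... | yes ≡.refl rewrite tv = s≤s z≤n
... | no _ = ℕₚ.≤-trans (countB>0 t v ps c tv) (ℕₚ.m≤n+m _ ⟦ t p ⟧ᵇ)

countB-All-true : ∀ t ps → All (λ p → t p ≡ true) ps → countB t ps ≡ length ps
countB-All-true t [] _ = ≡.refl
countB-All-true t (p ∷ ps) (tp ∷ a) rewrite tp = ≡.cong suc (countB-All-true t ps a)

map-Sorted : ∀ (f : ℕ → ℕ) → (∀ {x y} → y ≤ x → f y ≤ f x) → ∀ ps → Sorted ps → Sorted (map f ps)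
map-Sorted f mono [] _ = []
map-Sorted f mono (p ∷ []) _ = [-]
map-Sorted f mono (p ∷ q ∷ ps) (q≤p ∷ s) = mono q≤p ∷ map-Sorted f mono (q ∷ ps) s

sum-map-+ : ∀ m ps → sum (map (m ℕ.+_) ps) ≡ m ℕ.* length ps ℕ.+ sum ps
sum-map-+ m [] = ≡.sym (≡.trans (ℕₚ.+-identityʳ (m ℕ.* 0)) (ℕₚ.*-zeroʳ m))
sum-map-+ m (p ∷ ps) = ≡.trans (≡.cong ((m ℕ.+ p) ℕ.+_) (sum-map-+ m ps)) (regroup m p (length ps) (sum ps))
  where
  regroup : ∀ m p l s → (m ℕ.+ p) ℕ.+ (m ℕ.* l ℕ.+ s) ≡ m ℕ.* suc l ℕ.+ (p ℕ.+ s)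
  regroup = ℕ-solve-∀

All-delete : ∀ {P : ℕ → Set} v {l} → Sorted l → 0 < count v l → All P l → All P (delete v l)
All-delete {P} v {l} srt c a = All-insert⁻ v (delete v l) (≡.subst (All P) (≡.sym (insert-delete v l srt c)) a)

sum-delete : ∀ v {l n} → Sorted l → 0 < count v l → sum l ≡ n → sum (delete v l) ≡ n ∸ v
sum-delete v {l} {n} srt c sum≡n = ≡.trans (≡.sym (ℕₚ.m+n∸m≡n v _))
  (≡.cong (_∸ v) (≡.trans (≡.sym (sum-insert v (delete v l))) (≡.trans (≡.cong sum (insert-delete v l srt c)) sum≡n)))

sum-insert-∸ : ∀ v {l n} → v ≤ n → sum l ≡ n ∸ v → sum (insert v l) ≡ n
sum-insert-∸ v {l} v≤n sum≡ = ≡.trans (sum-insert v l) (≡.trans (≡.cong (v ℕ.+_) sum≡) (ℕₚ.m+[n∸m]≡n v≤n))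

module Capsids (m r₁ r₂ : ℕ) .{{_ : NonZero m}} (0<r₁ : 0 < r₁) (r₁<m : r₁ < m)
               (0<r₂ : 0 < r₂) (r₂<m : r₂ < m) (r₁≢r₂ : r₁ ≢ r₂) where

  private
    0<m : 0 < m
    0<m = ℕₚ.<-trans 0<r₁ r₁<m

    r₁%m : r₁ % m ≡ r₁
    r₁%m = m<n⇒m%n≡m r₁<m

    r₂%m : r₂ % m ≡ r₂
    r₂%m = m<n⇒m%n≡m r₂<m

    [m*a+r₂]%m : ∀ a → (m ℕ.* a ℕ.+ r₂) % m ≡ r₂
    [m*a+r₂]%m a = ≡.trans (≡.cong (_% m) (≡.trans (ℕₚ.+-comm (m ℕ.* a) r₂) (≡.cong (r₂ ℕ.+_) (ℕₚ.*-comm m a))))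
                           (≡.trans ([m+kn]%n≡m%n r₂ a m) r₂%m)

    [m*a]%m : ∀ a → (m ℕ.* a) % m ≡ 0
    [m*a]%m a = ≡.trans (≡.cong (_% m) (ℕₚ.*-comm m a)) (m*n%n≡0 a m)

    residue-form : ∀ {p r} → p % m ≡ r → p ≡ r ℕ.+ (p / m) ℕ.* m
    residue-form {p} p%m≡r = ≡.trans (m≡m%n+[m/n]*n p m) (≡.cong (ℕ._+ (p / m) ℕ.* m) p%m≡r)

    %≡r₂⇒[≤/m⇒m*<] : ∀ {p} a → p % m ≡ r₂ → a ≤ p / m → m ℕ.* a < p
    %≡r₂⇒[≤/m⇒m*<] {p} a p%m≡r₂ a≤q = ≡.subst (m ℕ.* a <_) (≡.sym (residue-form p%m≡r₂))
      (ℕₚ.<-≤-trans (ℕₚ.m<n+m (m ℕ.* a) 0<r₂)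
        (ℕₚ.+-monoʳ-≤ r₂ (≡.subst (_≤ (p / m) ℕ.* m) (ℕₚ.*-comm a m) (ℕₚ.*-monoˡ-≤ m a≤q))))

    %≡r₂⇒[m*<⇒≤/m] : ∀ {p} a → p % m ≡ r₂ → m ℕ.* a < p → a ≤ p / m
    %≡r₂⇒[m*<⇒≤/m] {p} a p%m≡r₂ m*a<p with a ℕ.≤? p / m
    ... | yes a≤q = a≤q
    ... | no a≰q = ⊥-elim (ℕₚ.<-irrefl ≡.refl
          (ℕₚ.<-≤-trans m*a<p (≡.subst (_≤ m ℕ.* a) (≡.sym (residue-form p%m≡r₂)) bound)))
      where
      q = p / m
      bound : r₂ ℕ.+ q ℕ.* m ≤ m ℕ.* a
      bound = ℕₚ.≤-trans (ℕₚ.<⇒≤ (ℕₚ.+-monoˡ-< (q ℕ.* m) r₂<m))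
        (≡.subst (_≤ m ℕ.* a) (≡.trans (ℕₚ.*-suc m q) (≡.cong (m ℕ.+_) (ℕₚ.*-comm m q)))
          (ℕₚ.*-monoʳ-≤ m (ℕₚ.≰⇒> a≰q)))

    %≡0⇒[/m≤⇒≤m*] : ∀ {p} a → p % m ≡ 0 → p / m ≤ a → p ≤ m ℕ.* a
    %≡0⇒[/m≤⇒≤m*] {p} a p%m≡0 q≤a = ≡.subst (_≤ m ℕ.* a) (≡.sym (residue-form p%m≡0))
      (≡.subst ((p / m) ℕ.* m ≤_) (ℕₚ.*-comm a m) (ℕₚ.*-monoˡ-≤ m q≤a))

    %≡0⇒[≤m*⇒/m≤] : ∀ {p} a → p % m ≡ 0 → p ≤ m ℕ.* a → p / m ≤ a
    %≡0⇒[≤m*⇒/m≤] {p} a p%m≡0 p≤m*a = ℕₚ.*-cancelʳ-≤ (p / m) a m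
      (≡.subst₂ _≤_ (residue-form p%m≡0) (ℕₚ.*-comm m a) p≤m*a)

    %≡r₂⇒[/m≡⇒≡m*+r₂] : ∀ {p} a → p % m ≡ r₂ → p / m ≡ a → p ≡ m ℕ.* a ℕ.+ r₂
    %≡r₂⇒[/m≡⇒≡m*+r₂] {p} a p%m≡r₂ q≡a = ≡.trans (residue-form p%m≡r₂)
      (≡.trans (ℕₚ.+-comm r₂ _) (≡.cong (ℕ._+ r₂) (≡.trans (≡.cong (ℕ._* m) q≡a) (ℕₚ.*-comm a m))))

    %≡r₂⇒[≡m*+r₂⇒/m≡] : ∀ {p} a → p % m ≡ r₂ → p ≡ m ℕ.* a ℕ.+ r₂ → p / m ≡ a
    %≡r₂⇒[≡m*+r₂⇒/m≡] {p} a p%m≡r₂ p≡ = ℕₚ.*-cancelʳ-≡ (p / m) a m (ℕₚ.+-cancelˡ-≡ r₂ _ _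
      (≡.trans (≡.sym (residue-form p%m≡r₂)) (≡.trans p≡ (≡.trans (ℕₚ.+-comm (m ℕ.* a) r₂) (≡.cong (r₂ ℕ.+_) (ℕₚ.*-comm m a))))))

    %≡0⇒[/m≡⇒≡m*] : ∀ {p} a → p % m ≡ 0 → p / m ≡ a → p ≡ m ℕ.* a
    %≡0⇒[/m≡⇒≡m*] {p} a p%m≡0 q≡a = ≡.trans (residue-form p%m≡0) (≡.trans (≡.cong (ℕ._* m) q≡a) (ℕₚ.*-comm a m))

    %≡0⇒[≡m*⇒/m≡] : ∀ {p} a → p % m ≡ 0 → p ≡ m ℕ.* a → p / m ≡ a
    %≡0⇒[≡m*⇒/m≡] {p} a p%m≡0 p≡ = ℕₚ.*-cancelʳ-≡ (p / m) a m
      (≡.trans (≡.sym (residue-form p%m≡0)) (≡.trans p≡ (ℕₚ.*-comm m a)))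

    r₂≢0-residue : ∀ {p} → p % m ≡ r₂ → p % m ≢ 0
    r₂≢0-residue p%m≡r₂ p%m≡0 = ℕₚ.<-irrefl (≡.trans (≡.sym p%m≡0) p%m≡r₂) 0<r₂

    r₁-residue≢r₂ : ∀ {p} → p ≡ r₁ → p % m ≢ r₂
    r₁-residue≢r₂ ≡.refl p%m≡r₂ = r₁≢r₂ (≡.trans (≡.sym r₁%m) p%m≡r₂)

    r₁-residue≢0 : ∀ {p} → p ≡ r₁ → p % m ≢ 0
    r₁-residue≢0 ≡.refl p%m≡0 = ℕₚ.<-irrefl (≡.trans (≡.sym p%m≡0) r₁%m) 0<r₁

  private
    AllowedPart-irrelevant : ∀ p → Irrelevant (AllowedPart m r₁ r₂ p)
    AllowedPart-irrelevant p (inj₁ e) (inj₁ e′) = ≡.cong inj₁ (ℕₚ.≡-irrelevant e e′)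
    AllowedPart-irrelevant p (inj₁ e) (inj₂ (inj₁ z)) = ⊥-elim (r₁-residue≢0 e z)
    AllowedPart-irrelevant p (inj₁ e) (inj₂ (inj₂ w)) = ⊥-elim (r₁-residue≢r₂ e w)
    AllowedPart-irrelevant p (inj₂ (inj₁ z)) (inj₁ e) = ⊥-elim (r₁-residue≢0 e z)
    AllowedPart-irrelevant p (inj₂ (inj₂ w)) (inj₁ e) = ⊥-elim (r₁-residue≢r₂ e w)
    AllowedPart-irrelevant p (inj₂ (inj₁ z)) (inj₂ (inj₁ z′)) = ≡.cong (inj₂ ∘ inj₁) (ℕₚ.≡-irrelevant z z′)
    AllowedPart-irrelevant p (inj₂ (inj₂ w)) (inj₂ (inj₂ w′)) = ≡.cong (inj₂ ∘ inj₂) (ℕₚ.≡-irrelevant w w′)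
    AllowedPart-irrelevant p (inj₂ (inj₁ z)) (inj₂ (inj₂ w)) = ⊥-elim (r₂≢0-residue w z)
    AllowedPart-irrelevant p (inj₂ (inj₂ w)) (inj₂ (inj₁ z)) = ⊥-elim (r₂≢0-residue w z)

    PartCondII-irrelevant : ∀ μ p → Irrelevant (PartCondII m r₁ r₂ μ p)
    PartCondII-irrelevant μ p (inj₁ e) (inj₁ e′) = ≡.cong inj₁ (ℕₚ.≡-irrelevant e e′)
    PartCondII-irrelevant μ p (inj₁ e) (inj₂ (inj₁ (z , _))) = ⊥-elim (r₁-residue≢0 e z)
    PartCondII-irrelevant μ p (inj₁ e) (inj₂ (inj₂ (w , _))) = ⊥-elim (r₁-residue≢r₂ e w)
    PartCondII-irrelevant μ p (inj₂ (inj₁ (z , _))) (inj₁ e) = ⊥-elim (r₁-residue≢0 e z)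
    PartCondII-irrelevant μ p (inj₂ (inj₂ (w , _))) (inj₁ e) = ⊥-elim (r₁-residue≢r₂ e w)
    PartCondII-irrelevant μ p (inj₂ (inj₁ (z , l))) (inj₂ (inj₁ (z′ , l′))) =
      ≡.cong₂ (λ u v → inj₂ (inj₁ (u , v))) (ℕₚ.≡-irrelevant z z′) (ℕₚ.≤-irrelevant l l′)
    PartCondII-irrelevant μ p (inj₂ (inj₂ (w , l))) (inj₂ (inj₂ (w′ , l′))) =
      ≡.cong₂ (λ u v → inj₂ (inj₂ (u , v))) (ℕₚ.≡-irrelevant w w′) (ℕₚ.<-irrelevant l l′)
    PartCondII-irrelevant μ p (inj₂ (inj₁ (z , _))) (inj₂ (inj₂ (w , _))) = ⊥-elim (r₂≢0-residue w z)
    PartCondII-irrelevant μ p (inj₂ (inj₂ (w , _))) (inj₂ (inj₁ (z , _))) = ⊥-elim (r₂≢0-residue w z)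

    IsCapsid-irrelevant : ∀ π → Irrelevant (IsCapsid m r₁ r₂ π)
    IsCapsid-irrelevant π (ap , c) (ap′ , c′) =
      ≡.cong₂ _,_ (All.irrelevant (AllowedPart-irrelevant _) ap ap′) (cases c c′)
      where
      cases : Irrelevant (((mult r₁ π ≡ 0) × All (λ p → p % m ≡ r₂) (parts π))
                ⊎ ((0 < mult r₁ π) × (All (r₁ ≤_) (parts π) × All (PartCondII m r₁ r₂ (mult r₁ π)) (parts π))))
      cases (inj₁ (e , a)) (inj₁ (e′ , a′)) =
        ≡.cong₂ (λ u v → inj₁ (u , v)) (ℕₚ.≡-irrelevant e e′) (All.irrelevant ℕₚ.≡-irrelevant a a′)
      cases (inj₂ (l , a , b)) (inj₂ (l′ , a′ , b′)) = ≡.cong₂ (λ u v → inj₂ (u , v)) (ℕₚ.<-irrelevant l l′)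
        (≡.cong₂ _,_ (All.irrelevant ℕₚ.≤-irrelevant a a′) (All.irrelevant (PartCondII-irrelevant _ _) b b′))
      cases (inj₁ (e , _)) (inj₂ (l , _)) = ⊥-elim (ℕₚ.<-irrefl (≡.sym e) l)
      cases (inj₂ (l , _)) (inj₁ (e , _)) = ⊥-elim (ℕₚ.<-irrefl (≡.sym e) l)

  Capsids : ℕ → ℕ → ℕ → Set
  Capsids = CapsidsWith m r₁ r₂

  partsOf : ∀ {a b n} → Capsids a b n → List ℕ
  partsOf x = proj₁ (proj₁ x)

  partsOf-injective : ∀ {a b n} (x y : Capsids a b n) → partsOf x ≡ partsOf y → x ≡ y
  partsOf-injective ((l , pos , srt) , cap , ae , be , se) ((.l , pos′ , srt′) , cap′ , ae′ , be′ , se′) ≡.refl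
    with ≡.refl ← All.irrelevant ℕₚ.<-irrelevant pos pos′ | ≡.refl ← Linked.irrelevant ℕₚ.≤-irrelevant srt srt′
    with ≡.refl ← IsCapsid-irrelevant (l , pos , srt) cap cap′
       | ≡.refl ← ℕₚ.≡-irrelevant ae ae′ | ≡.refl ← ℕₚ.≡-irrelevant be be′ | ≡.refl ← ℕₚ.≡-irrelevant se se′ = ≡.refl

  private
    Σ-≡-proj₁ : ∀ {A : Set} {P : A → Set} → (∀ x → Irrelevant (P x)) → ∀ {s t : Σ A P} → proj₁ s ≡ proj₁ t → s ≡ t
    Σ-≡-proj₁ P-irr {x , p} {.x , q} ≡.refl = ≡.cong (x ,_) (P-irr x p q)

  isβ : ℕ → Bool
  isβ p = ⌊ p % m ℕ.≟ r₂ ⌋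

  -- The condition on a single part of a capsid with α = a: for a = 0 condition (i),
  -- for a > 0 condition (ii) together with r₁ being the smallest part.
  Admissible : ℕ → ℕ → Set
  Admissible zero p = p % m ≡ r₂
  Admissible (suc a) p = (r₁ ≤ p) × PartCondII m r₁ r₂ (suc a) p

  private
    PartCondII⇒AllowedPart : ∀ μ p → PartCondII m r₁ r₂ μ p → AllowedPart m r₁ r₂ p
    PartCondII⇒AllowedPart μ p (inj₁ e) = inj₁ e
    PartCondII⇒AllowedPart μ p (inj₂ (inj₁ (z , _))) = inj₂ (inj₁ z)
    PartCondII⇒AllowedPart μ p (inj₂ (inj₂ (w , _))) = inj₂ (inj₂ w)

    IsCapsid⇒Admissible : ∀ a π → IsCapsid m r₁ r₂ π → mult r₁ π ≡ a → All (Admissible a) (parts π)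
    IsCapsid⇒Admissible zero π (_ , inj₁ (_ , residues)) _ = residues
    IsCapsid⇒Admissible zero π (_ , inj₂ (μ>0 , _)) μ≡0 = ⊥-elim (ℕₚ.<-irrefl (≡.sym μ≡0) μ>0)
    IsCapsid⇒Admissible (suc a) π (_ , inj₁ (μ≡0 , _)) μ≡1+a = ⊥-elim (ℕₚ.1+n≢0 (≡.trans (≡.sym μ≡1+a) μ≡0))
    IsCapsid⇒Admissible (suc a) π (_ , inj₂ (_ , r₁≤ , conds)) μ≡1+a =
      All.zip (r₁≤ , ≡.subst (λ μ → All (PartCondII m r₁ r₂ μ) (parts π)) μ≡1+a conds)

    Admissible⇒IsCapsid : ∀ a π → mult r₁ π ≡ a → All (Admissible a) (parts π) → IsCapsid m r₁ r₂ π
    Admissible⇒IsCapsid zero π μ≡0 adm = All.map (inj₂ ∘ inj₂) adm , inj₁ (μ≡0 , adm)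
    Admissible⇒IsCapsid (suc a) π μ≡1+a adm = All.map (PartCondII⇒AllowedPart (suc a) _ ∘ proj₂) adm ,
      inj₂ (≡.subst (0 <_) (≡.sym μ≡1+a) (s≤s z≤n) , All.map proj₁ adm ,
            ≡.subst (λ μ → All (PartCondII m r₁ r₂ μ) (parts π)) (≡.sym μ≡1+a) (All.map proj₂ adm))

  capsid : ∀ {a b n} (l : List ℕ) → All (0 <_) l → Sorted l → All (Admissible a) l →
    count r₁ l ≡ a → countB isβ l ≡ b → sum l ≡ n → Capsids a b n
  capsid {a} l pos srt adm α≡ β≡ size≡ = (l , pos , srt) , Admissible⇒IsCapsid a (l , pos , srt) α≡ adm , α≡ , β≡ , size≡

  module _ {a b n} (x : Capsids a b n) where
    positive : All (0 <_) (partsOf x)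
    positive = proj₁ (proj₂ (proj₁ x))
    sorted : Sorted (partsOf x)
    sorted = proj₂ (proj₂ (proj₁ x))
    α≡ : count r₁ (partsOf x) ≡ a
    α≡ = proj₁ (proj₂ (proj₂ x))
    β≡ : countB isβ (partsOf x) ≡ b
    β≡ = proj₁ (proj₂ (proj₂ (proj₂ x)))
    size≡ : sum (partsOf x) ≡ n
    size≡ = proj₂ (proj₂ (proj₂ (proj₂ x)))
    admissible : All (Admissible a) (partsOf x)
    admissible = IsCapsid⇒Admissible a (proj₁ x) (proj₁ (proj₂ x)) α≡

  Containing Avoiding : ℕ → ℕ → ℕ → ℕ → Set
  Containing v a b n = Σ (Capsids a b n) (λ x → 0 < count v (partsOf x))
  Avoiding v a b n = Σ (Capsids a b n) (λ x → count v (partsOf x) ≡ 0)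

  remove-part↔ : ∀ a b b′ n v → v ≢ r₁ → 0 < v → Admissible a v → ⟦ isβ v ⟧ᵇ ℕ.+ b′ ≡ b →
    Containing v a b n ↔ Shifted v (Capsids a b′) n
  remove-part↔ a b b′ n v v≢r₁ 0<v adm-v β-step = mk↔ₛ′ to from to∘from from∘to
    where
    to : Containing v a b n → Shifted v (Capsids a b′) n
    to (x , c) = v≤n , capsid l′ (All-delete v srt c (positive x)) (delete-Sorted v l srt) (All-delete v srt c (admissible x))
                                  α′ β′ (sum-delete v srt c (size≡ x))
      where
      l = partsOf x
      srt = sorted x
      l′ = delete v l
      reinsert : insert v l′ ≡ l
      reinsert = insert-delete v l srt c
      v≤n : v ≤ n
      v≤n = ≡.subst (v ≤_) (size≡ x) (count>0⇒≤sum v l c)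
      α′ : count r₁ l′ ≡ a
      α′ = ≡.trans (≡.sym (count-insert-other r₁ v l′ v≢r₁)) (≡.trans (≡.cong (count r₁) reinsert) (α≡ x))
      β′ : countB isβ l′ ≡ b′
      β′ = ℕₚ.+-cancelˡ-≡ ⟦ isβ v ⟧ᵇ _ _ (≡.trans (≡.sym (countB-insert isβ v l′))
             (≡.trans (≡.cong (countB isβ) reinsert) (≡.trans (β≡ x) (≡.sym β-step))))
    from : Shifted v (Capsids a b′) n → Containing v a b n
    from (v≤n , y) = capsid (insert v l′) (All-insert⁺ v l′ 0<v (positive y)) (insert-Sorted v l′ (sorted y))
                            (All-insert⁺ v l′ adm-v (admissible y))
                            (≡.trans (count-insert-other r₁ v l′ v≢r₁) (α≡ y))
                            (≡.trans (countB-insert isβ v l′) (≡.trans (≡.cong (⟦ isβ v ⟧ᵇ ℕ.+_) (β≡ y)) β-step))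
                            (sum-insert-∸ v {l′} v≤n (size≡ y))
                   , count-insert-self v l′
      where l′ = partsOf y
    to∘from : ∀ y → to (from y) ≡ y
    to∘from (v≤n , y) = ≡.cong₂ _,_ (ℕₚ.≤-irrelevant _ v≤n) (partsOf-injective _ y (delete-insert v (partsOf y)))
    from∘to : ∀ x → from (to x) ≡ x
    from∘to (x , c) = Σ-≡-proj₁ (λ _ → ℕₚ.<-irrelevant) (partsOf-injective _ x (insert-delete v (partsOf x) (sorted x) c))

  private
    r₁≢m*suc : ∀ a → r₁ ≢ m ℕ.* suc a
    r₁≢m*suc a r₁≡ = ℕₚ.<-irrefl r₁≡ (ℕₚ.<-≤-trans r₁<m (ℕₚ.m≤m*n m (suc a)))

    r₁≢m*+r₂ : ∀ a → r₁ ≢ m ℕ.* a ℕ.+ r₂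
    r₁≢m*+r₂ a r₁≡ = r₁≢r₂ (≡.trans (≡.sym r₁%m) (≡.trans (≡.cong (_% m) r₁≡) ([m*a+r₂]%m a)))

  -- Lowering α by one moves the threshold from m (a + 1) to m a: the admissible parts for a + 1 other
  -- than m (a + 1) are exactly the admissible parts for a other than m a + r₂.
  admissible-lower : ∀ a p → 0 < p → (p ≡ r₁ → 0 < a) → Admissible (suc a) p → p ≢ m ℕ.* suc a →
    Admissible a p × p ≢ m ℕ.* a ℕ.+ r₂
  admissible-lower a p 0<p r₁⇒0<a adm p≢ with p ℕ.≟ r₁
  admissible-lower zero p 0<p r₁⇒0<a adm p≢ | yes p≡r₁ = ⊥-elim (ℕₚ.<-irrefl ≡.refl (r₁⇒0<a p≡r₁))
  admissible-lower (suc a) p 0<p r₁⇒0<a adm p≢ | yes ≡.refl = (ℕₚ.≤-refl , inj₁ ≡.refl) , r₁≢m*+r₂ (suc a)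
  admissible-lower a p 0<p r₁⇒0<a (_ , inj₁ p≡r₁) p≢ | no p≢r₁ = ⊥-elim (p≢r₁ p≡r₁)
  admissible-lower a p 0<p r₁⇒0<a (r₁≤p , inj₂ (inj₁ (p%m≡0 , p≤))) p≢ | no p≢r₁ = lowered a q≤a
    where
    q≤a : p / m ≤ a
    q≤a with p / m ℕ.≟ suc a
    ... | yes q≡ = ⊥-elim (p≢ (%≡0⇒[/m≡⇒≡m*] (suc a) p%m≡0 q≡))
    ... | no q≢ = ℕₚ.≤-pred (ℕₚ.≤∧≢⇒< (%≡0⇒[≤m*⇒/m≤] (suc a) p%m≡0 p≤) q≢)
    lowered : ∀ a → p / m ≤ a → Admissible a p × p ≢ m ℕ.* a ℕ.+ r₂
    lowered zero q≤0 = ⊥-elim (ℕₚ.<-irrefl (≡.sym (≡.trans (residue-form p%m≡0)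
                         (≡.cong (ℕ._* m) (ℕₚ.n≤0⇒n≡0 q≤0)))) 0<p)
    lowered (suc a) q≤ = (r₁≤p , inj₂ (inj₁ (p%m≡0 , %≡0⇒[/m≤⇒≤m*] (suc a) p%m≡0 q≤))) ,
                         (λ p≡ → r₂≢0-residue (≡.trans (≡.cong (_% m) p≡) ([m*a+r₂]%m (suc a))) p%m≡0)
  admissible-lower zero p 0<p r₁⇒0<a (_ , inj₂ (inj₂ (p%m≡r₂ , m<p))) p≢ | no p≢r₁ =
    p%m≡r₂ , (λ p≡ → ℕₚ.<-irrefl (≡.sym (%≡r₂⇒[≡m*+r₂⇒/m≡] 0 p%m≡r₂ p≡)) (%≡r₂⇒[m*<⇒≤/m] 1 p%m≡r₂ m<p))
  admissible-lower (suc a) p 0<p r₁⇒0<a (r₁≤p , inj₂ (inj₂ (p%m≡r₂ , m<p))) p≢ | no p≢r₁ =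
    (r₁≤p , inj₂ (inj₂ (p%m≡r₂ , %≡r₂⇒[≤/m⇒m*<] (suc a) p%m≡r₂ (ℕₚ.<⇒≤ 2+a≤q)))) ,
    (λ p≡ → ℕₚ.<-irrefl (≡.sym (%≡r₂⇒[≡m*+r₂⇒/m≡] (suc a) p%m≡r₂ p≡)) 2+a≤q)
    where
    2+a≤q : suc (suc a) ≤ p / m
    2+a≤q = %≡r₂⇒[m*<⇒≤/m] (suc (suc a)) p%m≡r₂ m<p

  admissible-raise : ∀ a p → 0 < p → (p ≡ r₁ → 0 < a) → Admissible a p → p ≢ m ℕ.* a ℕ.+ r₂ →
    Admissible (suc a) p × p ≢ m ℕ.* suc a
  admissible-raise a p 0<p r₁⇒0<a adm p≢ with p ℕ.≟ r₁
  admissible-raise zero p 0<p r₁⇒0<a adm p≢ | yes p≡r₁ = ⊥-elim (ℕₚ.<-irrefl ≡.refl (r₁⇒0<a p≡r₁))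
  admissible-raise (suc a) p 0<p r₁⇒0<a adm p≢ | yes ≡.refl = (ℕₚ.≤-refl , inj₁ ≡.refl) , r₁≢m*suc (suc a)
  admissible-raise zero p 0<p r₁⇒0<a p%m≡r₂ p≢ | no p≢r₁ =
    (r₁≤p , inj₂ (inj₂ (p%m≡r₂ , m<p))) , (λ p≡ → r₂≢0-residue p%m≡r₂ (≡.trans (≡.cong (_% m) p≡) ([m*a]%m 1)))
    where
    m<p : m ℕ.* 1 < p
    m<p = %≡r₂⇒[≤/m⇒m*<] 1 p%m≡r₂ (ℕₚ.n≢0⇒n>0 (λ q≡0 → p≢ (%≡r₂⇒[/m≡⇒≡m*+r₂] 0 p%m≡r₂ q≡0)))
    r₁≤p : r₁ ≤ p
    r₁≤p = ℕₚ.≤-trans (ℕₚ.<⇒≤ r₁<m) (ℕₚ.≤-trans (ℕₚ.m≤m*n m 1) (ℕₚ.<⇒≤ m<p))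
  admissible-raise (suc a) p 0<p r₁⇒0<a (_ , inj₁ p≡r₁) p≢ | no p≢r₁ = ⊥-elim (p≢r₁ p≡r₁)
  admissible-raise (suc a) p 0<p r₁⇒0<a (r₁≤p , inj₂ (inj₁ (p%m≡0 , p≤))) p≢ | no p≢r₁ =
    (r₁≤p , inj₂ (inj₁ (p%m≡0 , ℕₚ.≤-trans p≤ (ℕₚ.*-monoʳ-≤ m (ℕₚ.n≤1+n (suc a)))))) ,
    (λ p≡ → ℕₚ.<-irrefl ≡.refl (≡.subst (_≤ suc a) (%≡0⇒[≡m*⇒/m≡] (suc (suc a)) p%m≡0 p≡)
                                         (%≡0⇒[≤m*⇒/m≤] (suc a) p%m≡0 p≤)))
  admissible-raise (suc a) p 0<p r₁⇒0<a (r₁≤p , inj₂ (inj₂ (p%m≡r₂ , m<p))) p≢ | no p≢r₁ =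
    (r₁≤p , inj₂ (inj₂ (p%m≡r₂ , %≡r₂⇒[≤/m⇒m*<] (suc (suc a)) p%m≡r₂ 2+a≤q))) ,
    (λ p≡ → r₂≢0-residue p%m≡r₂ (≡.trans (≡.cong (_% m) p≡) ([m*a]%m (suc (suc a)))))
    where
    2+a≤q : suc (suc a) ≤ p / m
    2+a≤q with p / m ℕ.≟ suc a
    ... | yes q≡ = ⊥-elim (p≢ (%≡r₂⇒[/m≡⇒≡m*+r₂] (suc a) p%m≡r₂ q≡))
    ... | no q≢ = ℕₚ.≤∧≢⇒< (%≡r₂⇒[m*<⇒≤/m] (suc a) p%m≡r₂ m<p) (q≢ ∘ ≡.sym)

  private
    r₁⇒0<α : ∀ a l → count r₁ l ≡ a → All (0 <_) l → All (λ p → p ≡ r₁ → 0 < a) l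
    r₁⇒0<α zero l none _ = All.map (λ p≢r₁ p≡r₁ → ⊥-elim (p≢r₁ p≡r₁)) (count≡0⇒All≢ r₁ l none)
    r₁⇒0<α (suc a) l _ pos = All.map (λ _ _ → s≤s z≤n) pos

    count-insert-r₁ : ∀ l → count r₁ (insert r₁ l) ≡ suc (count r₁ l)
    count-insert-r₁ l = ≡.trans (countB-insert (λ p → ⌊ p ℕ.≟ r₁ ⌋) r₁ l)
                                (≡.cong (λ z → ⟦ z ⟧ᵇ ℕ.+ count r₁ l) (⌊≟⌋-true {r₁} ≡.refl))

    isβ-insert-r₁ : ∀ l → countB isβ (insert r₁ l) ≡ countB isβ l
    isβ-insert-r₁ l = ≡.trans (countB-insert isβ r₁ l)
      (≡.cong (λ z → ⟦ z ⟧ᵇ ℕ.+ countB isβ l) (⌊≟⌋-false (r₁-residue≢r₂ ≡.refl)))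

    remove-r₁ : ∀ {a b n} → Avoiding (m ℕ.* suc a) (suc a) b n → Shifted r₁ (Avoiding (m ℕ.* a ℕ.+ r₂) a b) n
    remove-r₁ {a} {b} {n} (x , none) =
      r₁≤n , (capsid l′ pos′ (delete-Sorted r₁ l srt) (All.map proj₁ lowered) α′ β′ (sum-delete r₁ srt has-r₁ (size≡ x))
             , All≢⇒count≡0 _ l′ (All.map proj₂ lowered))
      where
      l = partsOf x
      srt = sorted x
      has-r₁ : 0 < count r₁ l
      has-r₁ = ≡.subst (0 <_) (≡.sym (α≡ x)) (s≤s z≤n)
      l′ = delete r₁ l
      reinsert : insert r₁ l′ ≡ l
      reinsert = insert-delete r₁ l srt has-r₁
      r₁≤n : r₁ ≤ n
      r₁≤n = ≡.subst (r₁ ≤_) (size≡ x) (count>0⇒≤sum r₁ l has-r₁)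
      pos′ : All (0 <_) l′
      pos′ = All-delete r₁ srt has-r₁ (positive x)
      α′ : count r₁ l′ ≡ a
      α′ = ℕₚ.suc-injective (≡.trans (≡.sym (count-insert-r₁ l′)) (≡.trans (≡.cong (count r₁) reinsert) (α≡ x)))
      β′ : countB isβ l′ ≡ b
      β′ = ≡.trans (≡.sym (isβ-insert-r₁ l′)) (≡.trans (≡.cong (countB isβ) reinsert) (β≡ x))
      lowered : All (λ p → Admissible a p × p ≢ m ℕ.* a ℕ.+ r₂) l′
      lowered = All.zipWith (λ (0<p , r₁⇒ , adm , p≢) → admissible-lower a _ 0<p r₁⇒ adm p≢)
        (pos′ , All.zip (r₁⇒0<α a l′ α′ pos′ ,
                         All-delete r₁ srt has-r₁ (All.zip (admissible x , count≡0⇒All≢ (m ℕ.* suc a) l none))))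
    insert-r₁ : ∀ {a b n} → Shifted r₁ (Avoiding (m ℕ.* a ℕ.+ r₂) a b) n → Avoiding (m ℕ.* suc a) (suc a) b n
    insert-r₁ {a} {b} {n} (r₁≤n , (y , none)) =
      capsid l (All-insert⁺ r₁ l′ 0<r₁ (positive y)) (insert-Sorted r₁ l′ (sorted y)) (All.map proj₁ raised)
             (≡.trans (count-insert-r₁ l′) (≡.cong suc (α≡ y))) (≡.trans (isβ-insert-r₁ l′) (β≡ y))
             (sum-insert-∸ r₁ {l′} r₁≤n (size≡ y))
      , All≢⇒count≡0 _ l (All.map proj₂ raised)
      where
      l′ = partsOf y
      l = insert r₁ l′
      raised : All (λ p → Admissible (suc a) p × p ≢ m ℕ.* suc a) l
      raised = All-insert⁺ r₁ l′ ((ℕₚ.≤-refl , inj₁ ≡.refl) , r₁≢m*suc a)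
        (All.zipWith (λ (0<p , r₁⇒ , adm , p≢) → admissible-raise a _ 0<p r₁⇒ adm p≢)
          (positive y , All.zip (r₁⇒0<α a l′ (α≡ y) (positive y) ,
                                 All.zip (admissible y , count≡0⇒All≢ _ l′ none))))

  remove-r₁↔ : ∀ a b n → Avoiding (m ℕ.* suc a) (suc a) b n ↔ Shifted r₁ (Avoiding (m ℕ.* a ℕ.+ r₂) a b) n
  remove-r₁↔ a b n = mk↔ₛ′ remove-r₁ insert-r₁
    (λ (r₁≤n , (y , _)) → ≡.cong₂ _,_ (ℕₚ.≤-irrelevant _ r₁≤n)
      (Σ-≡-proj₁ (λ _ → ℕₚ.≡-irrelevant) (partsOf-injective _ y (delete-insert r₁ (partsOf y)))))
    (λ (x , _) → Σ-≡-proj₁ (λ _ → ℕₚ.≡-irrelevant) (partsOf-injective _ x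
      (insert-delete r₁ (partsOf x) (sorted x) (≡.subst (0 <_) (≡.sym (α≡ x)) (s≤s z≤n)))))

  private
    map-map-id : ∀ (f g : ℕ → ℕ) l → All (λ p → g (f p) ≡ p) l → map g (map f l) ≡ l
    map-map-id f g l gf≡id = ≡.trans (≡.sym (map-∘ l)) (map-id-local gf≡id)

    count-r₁-α₀ : ∀ l → All (Admissible 0) l → count r₁ l ≡ 0
    count-r₁-α₀ l adm = All≢⇒count≡0 r₁ l (All.map (λ p%m≡r₂ p≡r₁ → r₁-residue≢r₂ p≡r₁ p%m≡r₂) adm)

    β-α₀ : ∀ l → All (Admissible 0) l → countB isβ l ≡ length l
    β-α₀ l adm = countB-All-true isβ l (All.map ⌊≟⌋-true adm)

    m+r₂≤ : ∀ {p} → Admissible 0 p → p ≢ r₂ → m ℕ.+ r₂ ≤ p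
    m+r₂≤ {p} p%m≡r₂ p≢r₂ = ≡.subst (m ℕ.+ r₂ ≤_) (≡.sym (residue-form p%m≡r₂))
      (≡.subst (_≤ r₂ ℕ.+ (p / m) ℕ.* m) (ℕₚ.+-comm r₂ m)
        (ℕₚ.+-monoʳ-≤ r₂ (≡.subst (_≤ (p / m) ℕ.* m) (ℕₚ.*-identityˡ m) (ℕₚ.*-monoˡ-≤ m 1≤q))))
      where
      1≤q : 1 ≤ p / m
      1≤q = ℕₚ.n≢0⇒n>0 (λ q≡0 → p≢r₂ (≡.trans (%≡r₂⇒[/m≡⇒≡m*+r₂] 0 p%m≡r₂ q≡0) (≡.cong (ℕ._+ r₂) (ℕₚ.*-zeroʳ m))))

    -- With α = 0 and no part r₂, all β parts are at least m + r₂ and can be lowered by m.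
    lower-parts : ∀ {b n} → Avoiding r₂ 0 (suc b) n → Shifted (m ℕ.* suc b) (Capsids 0 (suc b)) n
    lower-parts {b} {n} (x , none) =
      m*β≤n , capsid l′ pos′ (map-Sorted (_∸ m) (ℕₚ.∸-monoˡ-≤ m) l (sorted x)) adm′ (count-r₁-α₀ l′ adm′)
                     (≡.trans (β-α₀ l′ adm′) length′)
                     (≡.trans (≡.sym (ℕₚ.m+n∸m≡n (m ℕ.* suc b) (sum l′))) (≡.cong (_∸ m ℕ.* suc b) sum≡))
      where
      l = partsOf x
      l′ = map (_∸ m) l
      large : All (λ p → m ℕ.+ r₂ ≤ p) l
      large = All.zipWith (λ (adm , p≢r₂) → m+r₂≤ adm p≢r₂) (admissible x , count≡0⇒All≢ r₂ l none)
      m≤ : All (m ≤_) l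
      m≤ = All.map (ℕₚ.≤-trans (ℕₚ.m≤m+n m r₂)) large
      restore : map (m ℕ.+_) l′ ≡ l
      restore = map-map-id (_∸ m) (m ℕ.+_) l (All.map ℕₚ.m+[n∸m]≡n m≤)
      adm′ : All (Admissible 0) l′
      adm′ = Allₚ.map⁺ (All.zipWith (λ (m≤p , p%m≡r₂) → ≡.trans (m≤n⇒[n∸m]%m≡n%m m≤p) p%m≡r₂) (m≤ , admissible x))
      pos′ : All (0 <_) l′
      pos′ = Allₚ.map⁺ (All.map (λ m+r₂≤p → ℕₚ.<-≤-trans 0<r₂
               (ℕₚ.≤-trans (ℕₚ.≤-reflexive (≡.sym (ℕₚ.m+n∸m≡n m r₂))) (ℕₚ.∸-monoˡ-≤ m m+r₂≤p))) large)
      length′ : length l′ ≡ suc b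
      length′ = ≡.trans (length-map (_∸ m) l) (≡.trans (≡.sym (β-α₀ l (admissible x))) (β≡ x))
      sum≡ : m ℕ.* suc b ℕ.+ sum l′ ≡ n
      sum≡ = ≡.trans (≡.cong (λ k → m ℕ.* k ℕ.+ sum l′) (≡.sym length′))
               (≡.trans (≡.sym (sum-map-+ m l′)) (≡.trans (≡.cong sum restore) (size≡ x)))
      m*β≤n : m ℕ.* suc b ≤ n
      m*β≤n = ≡.subst (m ℕ.* suc b ≤_) sum≡ (ℕₚ.m≤m+n _ _)

    raise-parts : ∀ {b n} → Shifted (m ℕ.* suc b) (Capsids 0 (suc b)) n → Avoiding r₂ 0 (suc b) n
    raise-parts {b} {n} (m*β≤n , y) =
      capsid l (Allₚ.map⁺ (All.map (λ {p} _ → ℕₚ.≤-trans 0<m (ℕₚ.m≤m+n m p)) (positive y)))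
             (map-Sorted (m ℕ.+_) (ℕₚ.+-monoʳ-≤ m) l′ (sorted y)) adm (count-r₁-α₀ l adm)
             (≡.trans (β-α₀ l adm) (≡.trans (length-map (m ℕ.+_) l′) length′))
             (≡.trans (sum-map-+ m l′) (≡.trans (≡.cong₂ ℕ._+_ (≡.cong (m ℕ.*_) length′) (size≡ y)) (ℕₚ.m+[n∸m]≡n m*β≤n)))
      , All≢⇒count≡0 r₂ l (Allₚ.map⁺ (All.map (λ {p} _ m+p≡r₂ →
          ℕₚ.<-irrefl ≡.refl (ℕₚ.<-≤-trans r₂<m (≡.subst (m ≤_) m+p≡r₂ (ℕₚ.m≤m+n m p)))) (positive y)))
      where
      l′ = partsOf y
      l = map (m ℕ.+_) l′
      adm : All (Admissible 0) l
      adm = Allₚ.map⁺ (All.map (λ {p} p%m≡r₂ → ≡.trans (≡.cong (_% m) (ℕₚ.+-comm m p)) (≡.trans ([m+n]%n≡m%n p m) p%m≡r₂))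
                              (admissible y))
      length′ : length l′ ≡ suc b
      length′ = ≡.trans (≡.sym (β-α₀ l′ (admissible y))) (β≡ y)

  lower-parts↔ : ∀ b n → Avoiding r₂ 0 (suc b) n ↔ Shifted (m ℕ.* suc b) (Capsids 0 (suc b)) n
  lower-parts↔ b n = mk↔ₛ′ lower-parts raise-parts
    (λ (m*β≤n , y) → ≡.cong₂ _,_ (ℕₚ.≤-irrelevant _ m*β≤n)
      (partsOf-injective _ y (map-map-id (m ℕ.+_) (_∸ m) (partsOf y) (All.map (λ {p} _ → ℕₚ.m+n∸m≡n m p) (positive y)))))
    (λ (x , none) → Σ-≡-proj₁ (λ _ → ℕₚ.≡-irrelevant) (partsOf-injective _ x (map-map-id (_∸ m) (m ℕ.+_) (partsOf x)
      (All.zipWith (λ (adm , p≢r₂) → ℕₚ.m+[n∸m]≡n (ℕₚ.≤-trans (ℕₚ.m≤m+n m r₂) (m+r₂≤ adm p≢r₂)))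
                   (admissible x , count≡0⇒All≢ r₂ (partsOf x) none)))))

  private
    0<m*suc : ∀ a → 0 < m ℕ.* suc a
    0<m*suc a = ℕₚ.≤-trans 0<m (ℕₚ.m≤m*n m (suc a))

    0<m*+r₂ : ∀ a → 0 < m ℕ.* a ℕ.+ r₂
    0<m*+r₂ a = ℕₚ.≤-trans 0<r₂ (ℕₚ.m≤n+m r₂ (m ℕ.* a))

  remove-m*suc↔ : ∀ a b n → Containing (m ℕ.* suc a) (suc a) b n ↔ Shifted (m ℕ.* suc a) (Capsids (suc a) b) n
  remove-m*suc↔ a b n = remove-part↔ (suc a) b b n (m ℕ.* suc a) (r₁≢m*suc a ∘ ≡.sym) (0<m*suc a)
    (ℕₚ.≤-trans (ℕₚ.<⇒≤ r₁<m) (ℕₚ.m≤m*n m (suc a)) , inj₂ (inj₁ ([m*a]%m (suc a) , ℕₚ.≤-refl)))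
    (≡.cong (λ z → ⟦ z ⟧ᵇ ℕ.+ b) (⌊≟⌋-false (λ ≡r₂ → r₂≢0-residue ≡r₂ ([m*a]%m (suc a)))))

  remove-m*+r₂↔ : ∀ a b n → Containing (m ℕ.* a ℕ.+ r₂) a (suc b) n ↔ Shifted (m ℕ.* a ℕ.+ r₂) (Capsids a b) n
  remove-m*+r₂↔ a b n = remove-part↔ a (suc b) b n (m ℕ.* a ℕ.+ r₂) (r₁≢m*+r₂ a ∘ ≡.sym) (0<m*+r₂ a) (admissible-m*+r₂ a)
    (≡.cong (λ z → ⟦ z ⟧ᵇ ℕ.+ b) (⌊≟⌋-true ([m*a+r₂]%m a)))
    where
    admissible-m*+r₂ : ∀ a → Admissible a (m ℕ.* a ℕ.+ r₂)
    admissible-m*+r₂ zero = [m*a+r₂]%m 0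
    admissible-m*+r₂ (suc a) = ℕₚ.≤-trans (ℕₚ.<⇒≤ r₁<m) (ℕₚ.≤-trans (ℕₚ.m≤m*n m (suc a)) (ℕₚ.m≤m+n _ r₂)) ,
                              inj₂ (inj₂ ([m*a+r₂]%m (suc a) , ℕₚ.m<m+n (m ℕ.* suc a) 0<r₂))

  remove-r₂↔ : ∀ b n → Containing r₂ 0 (suc b) n ↔ Shifted r₂ (Capsids 0 b) n
  remove-r₂↔ b n = remove-part↔ 0 (suc b) b n r₂ (r₁≢r₂ ∘ ≡.sym) 0<r₂ r₂%m (≡.cong (λ z → ⟦ z ⟧ᵇ ℕ.+ b) (⌊≟⌋-true r₂%m))

  -- a part m a + r₂ would count towards β
  ¬Containing-m*+r₂-β₀ : ∀ a k → ¬ Containing (m ℕ.* a ℕ.+ r₂) a 0 k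
  ¬Containing-m*+r₂-β₀ a k (y , c) = ℕₚ.<-irrefl (≡.sym (β≡ y)) (countB>0 isβ (m ℕ.* a ℕ.+ r₂) (partsOf y) c (⌊≟⌋-true ([m*a+r₂]%m a)))

  private
    Capsids₀₀-parts : ∀ {n} (y : Capsids 0 0 n) → partsOf y ≡ []
    Capsids₀₀-parts y = length≡0 (partsOf y) (≡.trans (≡.sym (β-α₀ (partsOf y) (admissible y))) (β≡ y))
      where
      length≡0 : ∀ (l : List ℕ) → length l ≡ 0 → l ≡ []
      length≡0 [] _ = ≡.refl

  Finite-Capsids₀₀ : ∀ n → Finite (Capsids 0 0 n)
  Finite-Capsids₀₀ zero = Finite-singleton (capsid [] [] [] [] ≡.refl ≡.refl ≡.refl)
    (λ x y → partsOf-injective x y (≡.trans (Capsids₀₀-parts x) (≡.sym (Capsids₀₀-parts y))))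
  Finite-Capsids₀₀ (suc n) = Finite-⊥ empty
    where
    empty : ¬ Capsids 0 0 (suc n)
    empty y with partsOf y | Capsids₀₀-parts y | size≡ y
    ... | .[] | ≡.refl | ()

  private
    split↔ : ∀ v {a b n} → Capsids a b n ↔ (Containing v a b n ⊎ Avoiding v a b n)
    split↔ v = split-by-zero↔ (λ x → count v (partsOf x))

    Finite-Avoiding : ∀ v {a b n} → Finite (Capsids a b n) → Finite (Avoiding v a b n)
    Finite-Avoiding v fin = Finite-Σ fin _ (λ x → count v (partsOf x) ℕ.≟ 0) (λ _ → ℕₚ.≡-irrelevant)

    join : ∀ v {a b n} → Finite (Containing v a b n) → Finite (Avoiding v a b n) → Finite (Capsids a b n)
    join v with-v without-v = Finite-↔ (Finite-⊎ with-v without-v) (↔-sym (split↔ v))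

    split-0-suc : ∀ b n → Finite (Shifted r₂ (Capsids 0 b) n) → Finite (Shifted (m ℕ.* suc b) (Capsids 0 (suc b)) n) →
      Finite (Capsids 0 (suc b) n)
    split-0-suc b n A B = join r₂ (Finite-↔ A (↔-sym (remove-r₂↔ b n))) (Finite-↔ B (↔-sym (lower-parts↔ b n)))

    split-suc : ∀ a b n → Finite (Shifted (m ℕ.* suc a) (Capsids (suc a) b) n) →
      Finite (Shifted r₁ (Avoiding (m ℕ.* a ℕ.+ r₂) a b) n) → Finite (Capsids (suc a) b n)
    split-suc a b n A B = join (m ℕ.* suc a) (Finite-↔ A (↔-sym (remove-m*suc↔ a b n))) (Finite-↔ B (↔-sym (remove-r₁↔ a b n)))

    split-suc-β : ∀ a b k → Finite (Shifted (m ℕ.* a ℕ.+ r₂) (Capsids a b) k) →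
      Finite (Avoiding (m ℕ.* a ℕ.+ r₂) a (suc b) k) → Finite (Capsids a (suc b) k)
    split-suc-β a b k A B = join (m ℕ.* a ℕ.+ r₂) (Finite-↔ A (↔-sym (remove-m*+r₂↔ a b k))) B

    split-β₀ : ∀ a k → Finite (Avoiding (m ℕ.* a ℕ.+ r₂) a 0 k) → Finite (Capsids a 0 k)
    split-β₀ a k B = join (m ℕ.* a ℕ.+ r₂) (Finite-⊥ (¬Containing-m*+r₂-β₀ a k)) B

    ∸< : ∀ {v n} → 0 < v → v ≤ n → n ∸ v < n
    ∸< 0<v v≤n = ℕₚ.∸-monoʳ-< 0<v v≤n

  finite : ∀ a b n → Finite (Capsids a b n)
  finite zero b n = <-rec (λ n → ∀ b → Finite (Capsids 0 b n)) step n b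
    where
    step : ∀ n → (∀ {k} → k < n → ∀ b → Finite (Capsids 0 b k)) → ∀ b → Finite (Capsids 0 b n)
    step n ih zero = Finite-Capsids₀₀ n
    step n ih (suc b) = split-0-suc b n
      (Finite-Shifted r₂ n (Capsids 0 b) (λ r₂≤n → ih (∸< 0<r₂ r₂≤n) b))
      (Finite-Shifted (m ℕ.* suc b) n (Capsids 0 (suc b)) (λ ≤n → ih (∸< (0<m*suc b) ≤n) (suc b)))
  finite (suc a) b n = <-rec (λ n → ∀ b → Finite (Capsids (suc a) b n)) step n b
    where
    step : ∀ n → (∀ {k} → k < n → ∀ b → Finite (Capsids (suc a) b k)) → ∀ b → Finite (Capsids (suc a) b n)
    step n ih b = split-suc a b n
      (Finite-Shifted (m ℕ.* suc a) n (Capsids (suc a) b) (λ ≤n → ih (∸< (0<m*suc a) ≤n) b))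
      (Finite-Shifted r₁ n (Avoiding (m ℕ.* a ℕ.+ r₂) a b) (λ _ → Finite-Avoiding (m ℕ.* a ℕ.+ r₂) (finite a b (n ∸ r₁))))

  #Capsids : ℕ → ℕ → ℕ → ℕ
  #Capsids a b n = card (finite a b n)

  private
    #Capsidsᶻ : ℕ → ℕ → ℕ → ℤ
    #Capsidsᶻ a b n = + #Capsids a b n

    #Avoidingᶻ : ℕ → ℕ → ℕ → ℤ
    #Avoidingᶻ a b k = + card (Finite-Avoiding (m ℕ.* a ℕ.+ r₂) (finite a b k))

    #-0-suc : ∀ b n → #Capsidsᶻ 0 (suc b) n ≡ (q^ r₂ · #Capsidsᶻ 0 b) n ℤ.+ (q^ (m ℕ.* suc b) · #Capsidsᶻ 0 (suc b)) n
    #-0-suc b n = ≡.trans (≡.cong +_ (card-unique (finite 0 (suc b) n) (split-0-suc b n A B)))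
      (≡.trans (ℤₚ.pos-+ (card A) (card B)) (≡.cong₂ ℤ._+_ (card-Shifted r₂ n (finite 0 b) A) (card-Shifted (m ℕ.* suc b) n (finite 0 (suc b)) B)))
      where
      A = Finite-Shifted r₂ n (Capsids 0 b) (λ _ → finite 0 b (n ∸ r₂))
      B = Finite-Shifted (m ℕ.* suc b) n (Capsids 0 (suc b)) (λ _ → finite 0 (suc b) (n ∸ m ℕ.* suc b))

    #-suc : ∀ a b n → #Capsidsᶻ (suc a) b n ≡ (q^ (m ℕ.* suc a) · #Capsidsᶻ (suc a) b) n ℤ.+ (q^ r₁ · #Avoidingᶻ a b) n
    #-suc a b n = ≡.trans (≡.cong +_ (card-unique (finite (suc a) b n) (split-suc a b n A B)))
      (≡.trans (ℤₚ.pos-+ (card A) (card B))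
        (≡.cong₂ ℤ._+_ (card-Shifted (m ℕ.* suc a) n (finite (suc a) b) A)
                       (card-Shifted r₁ n (λ k → Finite-Avoiding (m ℕ.* a ℕ.+ r₂) (finite a b k)) B)))
      where
      A = Finite-Shifted (m ℕ.* suc a) n (Capsids (suc a) b) (λ _ → finite (suc a) b (n ∸ m ℕ.* suc a))
      B = Finite-Shifted r₁ n (Avoiding (m ℕ.* a ℕ.+ r₂) a b) (λ _ → Finite-Avoiding (m ℕ.* a ℕ.+ r₂) (finite a b (n ∸ r₁)))

    #-suc-β : ∀ a b k → #Capsidsᶻ a (suc b) k ≡ (q^ (m ℕ.* a ℕ.+ r₂) · #Capsidsᶻ a b) k ℤ.+ #Avoidingᶻ a (suc b) k
    #-suc-β a b k = ≡.trans (≡.cong +_ (card-unique (finite a (suc b) k) (split-suc-β a b k A B)))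
      (≡.trans (ℤₚ.pos-+ (card A) (card B)) (≡.cong (ℤ._+ #Avoidingᶻ a (suc b) k) (card-Shifted (m ℕ.* a ℕ.+ r₂) k (finite a b) A)))
      where
      A = Finite-Shifted (m ℕ.* a ℕ.+ r₂) k (Capsids a b) (λ _ → finite a b (k ∸ (m ℕ.* a ℕ.+ r₂)))
      B = Finite-Avoiding (m ℕ.* a ℕ.+ r₂) (finite a (suc b) k)

    #-β₀ : ∀ a k → #Capsidsᶻ a 0 k ≡ #Avoidingᶻ a 0 k
    #-β₀ a k = ≡.cong +_ (card-unique (finite a 0 k) (split-β₀ a k (Finite-Avoiding (m ℕ.* a ℕ.+ r₂) (finite a 0 k))))

  #Capsids-recurrence : CapsidRecurrence m r₁ r₂ (λ a b n → + #Capsids a b n)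
  #Capsids-recurrence = record
    { at-0-0 = λ n → ≡.trans (≡.cong +_ (card-unique (finite 0 0 n) (Finite-Capsids₀₀ n))) (empty-count n)
    ; at-0-suc = #-0-suc
    ; at-suc-0 = λ a n → ≡.trans (#-suc a 0 n)
        (≡.trans (ℤₚ.+-comm ((q^ (m ℕ.* suc a) · #Capsidsᶻ (suc a) 0) n) ((q^ r₁ · #Avoidingᶻ a 0) n))
        (≡.cong (ℤ._+ (q^ (m ℕ.* suc a) · #Capsidsᶻ (suc a) 0) n) (q^·-cong r₁ n (λ k _ → ≡.sym (#-β₀ a k)))))
    ; at-suc-suc = at-suc-suc
    }
    where
    empty-count : ∀ n → + card (Finite-Capsids₀₀ n) ≡ [ ⌊ n ℕ.≟ 0 ⌋ ]
    empty-count zero = ≡.refl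
    empty-count (suc n) = ≡.refl
    at-suc-suc : ∀ a b n → #Capsidsᶻ (suc a) (suc b) n ℤ.+ (q^ (r₁ ℕ.+ r₂) · q^ (m ℕ.* a) · #Capsidsᶻ a b) n
      ≡ (q^ (m ℕ.* suc a) · #Capsidsᶻ (suc a) (suc b)) n ℤ.+ (q^ r₁ · #Capsidsᶻ a (suc b)) n
    at-suc-suc a b n = begin
      #Capsidsᶻ (suc a) (suc b) n ℤ.+ W                           ≡⟨ ≡.cong (ℤ._+ W) (#-suc a (suc b) n) ⟩
      (X ℤ.+ N) ℤ.+ W                                             ≡⟨ ℤₚ.+-assoc X N W ⟩
      X ℤ.+ (N ℤ.+ W)                                             ≡⟨ ≡.cong (λ t → X ℤ.+ (N ℤ.+ t)) W≡ ⟩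
      X ℤ.+ (N ℤ.+ (q^ r₁ · q^ (m ℕ.* a ℕ.+ r₂) · #Capsidsᶻ a b) n) ≡⟨ ≡.cong (λ t → X ℤ.+ t) (q^·-distrib-+ r₁ n (#Avoidingᶻ a (suc b)) (q^ (m ℕ.* a ℕ.+ r₂) · #Capsidsᶻ a b)) ⟨
      X ℤ.+ (q^ r₁ · (λ k → #Avoidingᶻ a (suc b) k ℤ.+ (q^ (m ℕ.* a ℕ.+ r₂) · #Capsidsᶻ a b) k)) n
        ≡⟨ ≡.cong (λ t → X ℤ.+ t) (q^·-cong r₁ n (λ k _ → ≡.trans (ℤₚ.+-comm (#Avoidingᶻ a (suc b) k) ((q^ (m ℕ.* a ℕ.+ r₂) · #Capsidsᶻ a b) k))
                                                  (≡.sym (#-suc-β a b k)))) ⟩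
      X ℤ.+ (q^ r₁ · #Capsidsᶻ a (suc b)) n                        ∎
      where
      open ≡.≡-Reasoning
      W = (q^ (r₁ ℕ.+ r₂) · q^ (m ℕ.* a) · #Capsidsᶻ a b) n
      X = (q^ (m ℕ.* suc a) · #Capsidsᶻ (suc a) (suc b)) n
      N = (q^ r₁ · #Avoidingᶻ a (suc b)) n
      W≡ : W ≡ (q^ r₁ · q^ (m ℕ.* a ℕ.+ r₂) · #Capsidsᶻ a b) n
      W≡ = ≡.trans (q^·-q^· (r₁ ℕ.+ r₂) (m ℕ.* a) n (#Capsidsᶻ a b)) (≡.trans (≡.cong (λ s → (q^ s · #Capsidsᶻ a b) n) exponents)
                   (≡.sym (q^·-q^· r₁ (m ℕ.* a ℕ.+ r₂) n (#Capsidsᶻ a b))))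
        where
        exponents : r₁ ℕ.+ r₂ ℕ.+ m ℕ.* a ≡ r₁ ℕ.+ (m ℕ.* a ℕ.+ r₂)
        exponents = ≡.trans (ℕₚ.+-assoc r₁ r₂ _) (≡.cong (r₁ ℕ.+_) (ℕₚ.+-comm r₂ _))

proposition6p1 : (m r₁ r₂ : ℕ) .{{_ : NonZero m}} → 2 ≤ m → 0 < r₁ → r₁ < m → 0 < r₂ → r₂ < m → r₁ ≢ r₂ →
    (a b n : ℕ) → Σ ℕ (λ k → (Fin k ↔ CapsidsWith m r₁ r₂ a b n) × (capsidRHS m r₁ r₂ a b n ≡ + k))
proposition6p1 m r₁ r₂ _ 0<r₁ r₁<m 0<r₂ r₂<m r₁≢r₂ a b n =
  #Capsids a b n , proj₂ (finite a b n) ,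
  CapsidRecurrence-unique 0<m 0<r₂ F-recurrence #Capsids-recurrence a b n
  where
  0<m = ℕₚ.<-trans 0<r₁ r₁<m
  open Capsids m r₁ r₂ 0<r₁ r₁<m 0<r₂ r₂<m r₁≢r₂
  open CapsidProduct m r₁ r₂ 0<m 0<r₁ 0<r₂
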